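{- Let $G=(V,E)$ be a finite connected graph with $|V|=n$, and let $\pi$ be a uniformly random bijection $V\to\{1,\dots,n\}$. For each $v\in V$ let $G_v$ be the event that $\pi(v)=1$ or there exists a neighbour $u$ of $v$ with $\pi(u)<\pi(v)$, and for $U\subseteq V$ let $G_U=\bigcap_{v\in U}G_v$ (with $G_\varnothing$ the whole probability space). Then for every $U\subseteq V$, $$\Pr(G_U)=\sum_{\substack{I\subseteq U\\ I\ \text{independent}}}(-1)^{|I|}\frac{a(I)\,b(I)}{n},$$ where $a(I)=n-|I|-|N(I)|$ and $b$ is defined on independent sets by $b(\varnothing)=1$ and $b(I)=\frac{1}{n-a(I)}\sum_{v\in I}b(I\setminus\{v\})$ for $I\ne\varnothing$.
   Context: $N(I)$ denotes the set of vertices adjacent to at least one vertex of $I$, and $N[I]=I\cup N(I)$, so $a(I)=|V\setminus N[I]|$. A set is independent if no two of its vertices are adjacent. -}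

module Defs where

open import Data.Bool using (Bool; true; false; if_then_else_; _∧_; _∨_; not)
open import Data.Nat as ℕ using (ℕ; zero; suc; _∸_; _<ᵇ_)
open import Data.Fin using (Fin; zero; suc; toℕ; _≟_)
open import Data.Fin.Subset using (Subset; ∣_∣; outside)
open import Data.Vec using (Vec; []; _∷_; lookup; _[_]≔_; tabulate; toList)
open import Data.List as L using (List; []; _∷_; filter; length; map; foldr; _++_; concatMap)
open import Data.List.Base using (allFin)
open import Data.Integer using (+_)
open import Data.Rational using (ℚ; _/_; _+_; _*_; -_; 0ℚ; 1ℚ)
open import Relation.Binary.PropositionalEquality using (_≡_)
open import Relation.Nullary.Decidable using (⌊_⌋)

record Graph (n : ℕ) : Set where
  field
    adj     : Fin n → Fin n → Bool
    sym     : ∀ u v → adj u v ≡ adj v u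
    irrefl  : ∀ v → adj v v ≡ false
open Graph public

data Reach {n : ℕ} (G : Graph n) : Fin n → Fin n → Set where
  here : ∀ {v} → Reach G v v
  step : ∀ {u w v} → adj G u w ≡ true → Reach G w v → Reach G u v

Connected : ∀ {n} → Graph n → Set
Connected {n} G = ∀ (u v : Fin n) → Reach G u v

anyV : ∀ {n} → (Fin n → Bool) → Bool
anyV {n} p = foldr (λ v b → p v ∨ b) false (allFin n)

allV : ∀ {n} → (Fin n → Bool) → Bool
allV {n} p = foldr (λ v b → p v ∧ b) true (allFin n)

sumV : ∀ {n} → (Fin n → ℚ) → ℚ
sumV {n} f = foldr (λ v q → f v + q) 0ℚ (allFin n)

countL : ∀ {A : Set} → (A → Bool) → List A → ℕ
countL p xs = length (L.filter (λ x → Data.Bool.T? (p x)) xs)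
  where import Data.Bool

-- ℚ-valued reciprocal of a natural number; the value at 0 is an irrelevant convention (never used).
inv : ℕ → ℚ
inv zero    = 0ℚ
inv (suc m) = + 1 / suc m

fromℕ : ℕ → ℚ
fromℕ k = + k / 1

sign : ℕ → ℚ
sign zero    = 1ℚ
sign (suc k) = - sign k

mem : ∀ {n} → Subset n → Fin n → Bool
mem S v = lookup S v

subsetOf : ∀ {n} → Subset n → Subset n → Bool
subsetOf I U = allV (λ v → not (mem I v) ∨ mem U v)

independent : ∀ {n} → Graph n → Subset n → Bool
independent G I = allV (λ u → allV (λ v → not (mem I u ∧ mem I v ∧ adj G u v)))

inClosedNbhd : ∀ {n} → Graph n → Subset n → Fin n → Bool
inClosedNbhd G I v = mem I v ∨ anyV (λ u → mem I u ∧ adj G u v)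

a : ∀ {n} → Graph n → Subset n → ℕ
a {n} G I = countL (λ v → not (inClosedNbhd G I v)) (allFin n)

bAux : ∀ {n} → Graph n → ℕ → Subset n → ℚ
bAux G zero    I = 1ℚ
bAux {n} G (suc k) I =
  if anyV (mem I)
  then inv (n ∸ a G I) * sumV (λ v → if mem I v then bAux G k (I [ v ]≔ outside) else 0ℚ)
  else 1ℚ

b : ∀ {n} → Graph n → Subset n → ℚ
b G I = bAux G ∣ I ∣ I

subsets : ∀ n → List (Subset n)
subsets zero    = [] ∷ []
subsets (suc n) = map (false ∷_) (subsets n) ++ map (true ∷_) (subsets n)

-- Bijections V → {1,…,n}, encoded as π : Vec (Fin n) n with value 0 standing for rank 1.

vecs : ∀ (m k : ℕ) → List (Vec (Fin m) k)
vecs m zero    = [] ∷ []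
vecs m (suc k) = concatMap (λ i → map (i ∷_) (vecs m k)) (allFin m)

injective : ∀ {n} → Vec (Fin n) n → Bool
injective π = allV (λ u → allV (λ v → not ⌊ lookup π u ≟ lookup π v ⌋ ∨ ⌊ u ≟ v ⌋))

bijections : ∀ n → List (Vec (Fin n) n)
bijections n = L.filter (λ π → Data.Bool.T? (injective π)) (vecs n n)
  where import Data.Bool

Gv : ∀ {n} → Graph n → Vec (Fin n) n → Fin n → Bool
Gv G π v = (toℕ (lookup π v) ℕ.≡ᵇ 0) ∨ anyV (λ u → adj G u v ∧ (toℕ (lookup π u) <ᵇ toℕ (lookup π v)))

GU : ∀ {n} → Graph n → Subset n → Vec (Fin n) n → Bool
GU G U π = allV (λ v → not (mem U v) ∨ Gv G π v)

Pr : ∀ {n} → Graph n → Subset n → ℚ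
Pr {n} G U = fromℕ (countL (GU G U) (bijections n)) * inv (length (bijections n))

rhs : ∀ {n} → Graph n → Subset n → ℚ
rhs {n} G U =
  foldr _+_ 0ℚ
    (map (λ I → sign ∣ I ∣ * fromℕ (a G I) * b G I * inv n)
         (L.filter (λ I → Data.Bool.T? (subsetOf I U ∧ independent G I)) (subsets n)))
  where import Data.Bool

{-# OPTIONS --safe #-}
-- Inclusion–exclusion turns Pr(G_U) into Σ_{I ⊆ U} (-1)^|I| Pr(no v ∈ I satisfies G_v), and v fails
-- G_v exactly when it is a local minimum of π that is not ranked first.  Adjacent vertices cannot both
-- be local minima, so only independent I contribute.  For independent I, reveal π one vertex at a
-- time.  If the revealed prefix avoids N[I] and r vertices remain, there are b(I) r! completions in
-- which every vertex of I is a local minimum: the next vertex either lies in I (it is then a local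
-- minimum and I shrinks to I ∖ {v}), or in N(I) ∖ I (a vertex of I gets a smaller neighbour), or
-- outside N[I] (nothing changes).  Since |N[I]| = n - a(I), the recurrence defining b is exactly what
-- makes these three cases add up to b(I) r!.  Asking in addition that the first vertex lies outside
-- N[I] leaves a(I) b(I) (n-1)! bijections, i.e. probability a(I) b(I) / n.
module Submission where

open import Defs hiding (sym)
open Graph using () renaming (sym to adj-sym)
open import Data.Nat using (ℕ; _≤_)
open import Data.Fin.Subset using (Subset)
open import Relation.Binary.PropositionalEquality using (_≡_)
open import Relation.Binary.Definitions using (Tri; tri<; tri≈; tri>)

open import Relation.Binary.PropositionalEquality
  using (refl; sym; trans; cong; cong₂; subst; _≢_; module ≡-Reasoning)
open import Data.Nat as ℕ using (zero; suc; _∸_; _<_; _!; z≤n; s≤s; NonZero)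
import Data.Nat.Properties as ℕP
open import Data.Integer as ℤ using ()
import Data.Integer.Properties as ℤP
open import Data.Rational using (ℚ; 0ℚ; 1ℚ; _+_; _*_; -_; toℚᵘ)
import Data.Rational.Properties as ℚP
import Data.Rational.Unnormalised as ℚᵘ
import Data.Rational.Unnormalised.Properties as ℚᵘP
open import Data.Rational.Solver using (module +-*-Solver)
open import Algebra.Properties.Group ℚP.+-0-group using () renaming (∙-cancelˡ to +-cancelˡ)
open import Algebra.Bundles using (CommutativeMonoid)
open import Algebra.Properties.CommutativeSemigroup (CommutativeMonoid.commutativeSemigroup ℚP.+-0-commutativeMonoid)
  using (interchange)
open import Data.Bool as B using (Bool; true; false; if_then_else_; _∧_; _∨_; not)
import Data.Bool.Properties as BP
open import Data.Fin as F using (Fin; toℕ; _≟_)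
import Data.Fin.Properties as FP
open import Data.Fin.Subset using (∣_∣)
open import Data.Vec using (Vec; []; _∷_; lookup; tabulate; _[_]≔_)
import Data.Vec.Properties as VP
open import Data.List using (List; []; _∷_; length; foldr; filter; map; _++_; concat; allFin)
import Data.List.Properties as LP
open import Data.List.Membership.Propositional using (_∈_)
open import Data.List.Membership.Propositional.Properties using (∈-allFin; ∈-filter⁻)
open import Data.List.Relation.Unary.Any using (here; there)
open import Data.Product using (∃-syntax; _×_; _,_; proj₂)
open import Data.Sum using (_⊎_; inj₁; inj₂)
open import Data.Empty using (⊥; ⊥-elim)
open import Data.Unit using (⊤; tt)
open import Data.Nat.DivMod using (_mod_; m<n⇒m%n≡m)
open import Function.Bundles using (Equivalence)
open import Relation.Nullary using (Dec; yes; no)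
open import Relation.Nullary.Decidable using (⌊_⌋; isYes≗does; dec-true; dec-false; toWitness)
open import Function using (_∘_; id)

ιᵘ : ℕ → ℚᵘ.ℚᵘ
ιᵘ k = ℚᵘ.mkℚᵘ (ℤ.+ k) 0

-- fromℕ k = + k / 1 normalises by a gcd computation that is stuck on variables, but it is
-- definitionally fromℚᵘ (ιᵘ k); the arithmetic of fromℕ is therefore done in ℚᵘ.
toℚᵘ-fromℕ : ∀ k → toℚᵘ (fromℕ k) ℚᵘ.≃ ιᵘ k
toℚᵘ-fromℕ k = ℚP.toℚᵘ-fromℚᵘ (ιᵘ k)

fromℕ-+ : ∀ j k → fromℕ (j ℕ.+ k) ≡ fromℕ j + fromℕ k
fromℕ-+ j k = ℚP.toℚᵘ-injective (begin
  toℚᵘ (fromℕ (j ℕ.+ k))              ≈⟨ toℚᵘ-fromℕ (j ℕ.+ k) ⟩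
  ιᵘ (j ℕ.+ k)                         ≈⟨ ℚᵘ.*≡* (cong (ℤ._* ℤ.+ 1) numerators) ⟩
  ιᵘ j ℚᵘ.+ ιᵘ k                       ≈⟨ ℚᵘP.+-cong (toℚᵘ-fromℕ j) (toℚᵘ-fromℕ k) ⟨
  toℚᵘ (fromℕ j) ℚᵘ.+ toℚᵘ (fromℕ k)  ≈⟨ ℚP.toℚᵘ-homo-+ (fromℕ j) (fromℕ k) ⟨
  toℚᵘ (fromℕ j + fromℕ k)            ∎)
  where
  open ℚᵘP.≃-Reasoning
  numerators : ℤ.+ (j ℕ.+ k) ≡ ℤ.+ j ℤ.* ℤ.+ 1 ℤ.+ ℤ.+ k ℤ.* ℤ.+ 1
  numerators = trans (ℤP.pos-+ j k) (sym (cong₂ ℤ._+_ (ℤP.*-identityʳ (ℤ.+ j)) (ℤP.*-identityʳ (ℤ.+ k))))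

fromℕ-* : ∀ j k → fromℕ (j ℕ.* k) ≡ fromℕ j * fromℕ k
fromℕ-* zero    k = sym (ℚP.*-zeroˡ (fromℕ k))
fromℕ-* (suc j) k = begin
  fromℕ (k ℕ.+ j ℕ.* k)             ≡⟨ fromℕ-+ k (j ℕ.* k) ⟩
  fromℕ k + fromℕ (j ℕ.* k)         ≡⟨ cong₂ _+_ (sym (ℚP.*-identityˡ (fromℕ k))) (fromℕ-* j k) ⟩
  1ℚ * fromℕ k + fromℕ j * fromℕ k  ≡⟨ ℚP.*-distribʳ-+ (fromℕ k) 1ℚ (fromℕ j) ⟨
  (1ℚ + fromℕ j) * fromℕ k          ≡⟨ cong (_* fromℕ k) (fromℕ-+ 1 j) ⟨
  fromℕ (suc j) * fromℕ k           ∎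
  where open ≡-Reasoning

fromℕ-injective : ∀ {j k} → fromℕ j ≡ fromℕ k → j ≡ k
fromℕ-injective {j} {k} eq
  with ℚᵘP.≃-trans (ℚᵘP.≃-sym (toℚᵘ-fromℕ j)) (ℚᵘP.≃-trans (ℚP.toℚᵘ-cong eq) (toℚᵘ-fromℕ k))
... | ℚᵘ.*≡* j*1≡k*1 = ℤP.+-injective (begin
  ℤ.+ j            ≡⟨ ℤP.*-identityʳ (ℤ.+ j) ⟨
  ℤ.+ j ℤ.* ℤ.+ 1  ≡⟨ j*1≡k*1 ⟩
  ℤ.+ k ℤ.* ℤ.+ 1  ≡⟨ ℤP.*-identityʳ (ℤ.+ k) ⟩
  ℤ.+ k            ∎)
  where open ≡-Reasoning

fromℕ*inv : ∀ k .{{_ : NonZero k}} → fromℕ k * inv k ≡ 1ℚ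
fromℕ*inv (suc m) = ℚP.toℚᵘ-injective (begin
  toℚᵘ (fromℕ (suc m) * inv (suc m))
    ≈⟨ ℚP.toℚᵘ-homo-* (fromℕ (suc m)) (inv (suc m)) ⟩
  toℚᵘ (fromℕ (suc m)) ℚᵘ.* toℚᵘ (inv (suc m))
    ≈⟨ ℚᵘP.*-cong (toℚᵘ-fromℕ (suc m)) (ℚP.toℚᵘ-fromℚᵘ (ℚᵘ.mkℚᵘ (ℤ.+ 1) m)) ⟩
  ιᵘ (suc m) ℚᵘ.* ℚᵘ.mkℚᵘ (ℤ.+ 1) m
    ≈⟨ ℚᵘ.*≡* numerators ⟩
  toℚᵘ 1ℚ ∎)
  where
  open ℚᵘP.≃-Reasoning
  numerators : (ℤ.+ suc m ℤ.* ℤ.+ 1) ℤ.* ℤ.+ 1 ≡ ℤ.+ 1 ℤ.* ℤ.+ (1 ℕ.* suc m)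
  numerators = trans (ℤP.*-identityʳ _) (trans (ℤP.*-identityʳ _)
                 (trans (cong ℤ.+_ (sym (ℕP.*-identityˡ (suc m)))) (sym (ℤP.*-identityˡ _))))

Sum : {A : Set} → List A → (A → ℚ) → ℚ
Sum xs f = foldr (λ x q → f x + q) 0ℚ xs

⟦_⟧ : Bool → ℚ
⟦ true ⟧  = 1ℚ
⟦ false ⟧ = 0ℚ

⟦∧⟧ : ∀ x y → ⟦ x ∧ y ⟧ ≡ ⟦ x ⟧ * ⟦ y ⟧
⟦∧⟧ false y = sym (ℚP.*-zeroˡ ⟦ y ⟧)
⟦∧⟧ true  y = sym (ℚP.*-identityˡ ⟦ y ⟧)

module _ {A : Set} where

  Sum-cong : ∀ (xs : List A) {f g : A → ℚ} → (∀ x → f x ≡ g x) → Sum xs f ≡ Sum xs g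
  Sum-cong []       f≡g = refl
  Sum-cong (x ∷ xs) f≡g = cong₂ _+_ (f≡g x) (Sum-cong xs f≡g)

  Sum-cong-∈ : ∀ (xs : List A) {f g : A → ℚ} → (∀ {x} → x ∈ xs → f x ≡ g x) → Sum xs f ≡ Sum xs g
  Sum-cong-∈ []       f≡g = refl
  Sum-cong-∈ (x ∷ xs) f≡g = cong₂ _+_ (f≡g (here refl)) (Sum-cong-∈ xs (f≡g ∘ there))

  Sum-zero : ∀ (xs : List A) {f : A → ℚ} → (∀ {x} → x ∈ xs → f x ≡ 0ℚ) → Sum xs f ≡ 0ℚ
  Sum-zero []       f≡0 = refl
  Sum-zero (x ∷ xs) f≡0 = trans (cong₂ _+_ (f≡0 (here refl)) (Sum-zero xs (f≡0 ∘ there))) (ℚP.+-identityˡ 0ℚ)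

  Sum-+ : ∀ (xs : List A) (f g : A → ℚ) → Sum xs (λ x → f x + g x) ≡ Sum xs f + Sum xs g
  Sum-+ []       f g = refl
  Sum-+ (x ∷ xs) f g = trans (cong ((f x + g x) +_) (Sum-+ xs f g)) (interchange (f x) (g x) (Sum xs f) (Sum xs g))

  Sum-*ˡ : ∀ (xs : List A) (c : ℚ) (f : A → ℚ) → Sum xs (λ x → c * f x) ≡ c * Sum xs f
  Sum-*ˡ []       c f = sym (ℚP.*-zeroʳ c)
  Sum-*ˡ (x ∷ xs) c f = trans (cong (c * f x +_) (Sum-*ˡ xs c f)) (sym (ℚP.*-distribˡ-+ c (f x) (Sum xs f)))

  Sum-*ʳ : ∀ (xs : List A) (c : ℚ) (f : A → ℚ) → Sum xs (λ x → f x * c) ≡ Sum xs f * c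
  Sum-*ʳ xs c f = trans (Sum-cong xs (λ x → ℚP.*-comm (f x) c)) (trans (Sum-*ˡ xs c f) (ℚP.*-comm c _))

  Sum-neg : ∀ (xs : List A) (f : A → ℚ) → Sum xs (λ x → - f x) ≡ - Sum xs f
  Sum-neg []       f = refl
  Sum-neg (x ∷ xs) f = trans (cong (- f x +_) (Sum-neg xs f)) (sym (ℚP.neg-distrib-+ (f x) (Sum xs f)))

  Sum-++ : ∀ (xs ys : List A) (f : A → ℚ) → Sum (xs ++ ys) f ≡ Sum xs f + Sum ys f
  Sum-++ []       ys f = sym (ℚP.+-identityˡ _)
  Sum-++ (x ∷ xs) ys f = trans (cong (f x +_) (Sum-++ xs ys f)) (sym (ℚP.+-assoc (f x) _ _))

  Sum-filter : ∀ (xs : List A) (p : A → Bool) (f : A → ℚ) →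
               Sum (filter (B.T? ∘ p) xs) f ≡ Sum xs (λ x → if p x then f x else 0ℚ)
  Sum-filter []       p f = refl
  Sum-filter (x ∷ xs) p f with p x
  ... | true  = cong (f x +_) (Sum-filter xs p f)
  ... | false = trans (Sum-filter xs p f) (sym (ℚP.+-identityˡ _))

  Sum-one : ∀ (xs : List A) → Sum xs (λ _ → 1ℚ) ≡ fromℕ (length xs)
  Sum-one []       = refl
  Sum-one (x ∷ xs) = trans (cong (1ℚ +_) (Sum-one xs)) (sym (fromℕ-+ 1 (length xs)))

  fromℕ-countL : ∀ (p : A → Bool) (xs : List A) → fromℕ (countL p xs) ≡ Sum xs (λ x → ⟦ p x ⟧)
  fromℕ-countL p []       = refl
  fromℕ-countL p (x ∷ xs) with p x
  ... | true  = trans (fromℕ-+ 1 (countL p xs)) (cong (1ℚ +_) (fromℕ-countL p xs))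
  ... | false = trans (fromℕ-countL p xs) (sym (ℚP.+-identityˡ _))

  Sum-⟦⟧+Sum-⟦not⟧ : ∀ (q : A → Bool) (xs : List A) →
                     Sum xs (λ x → ⟦ q x ⟧) + Sum xs (λ x → ⟦ not (q x) ⟧) ≡ fromℕ (length xs)
  Sum-⟦⟧+Sum-⟦not⟧ q xs = begin
    Sum xs (λ x → ⟦ q x ⟧) + Sum xs (λ x → ⟦ not (q x) ⟧)
      ≡⟨ Sum-+ xs (λ x → ⟦ q x ⟧) (λ x → ⟦ not (q x) ⟧) ⟨
    Sum xs (λ x → ⟦ q x ⟧ + ⟦ not (q x) ⟧)
      ≡⟨ Sum-cong xs (λ x → ⟦⟧+⟦not⟧ (q x)) ⟩
    Sum xs (λ _ → 1ℚ)
      ≡⟨ Sum-one xs ⟩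
    fromℕ (length xs) ∎
    where
    open ≡-Reasoning
    ⟦⟧+⟦not⟧ : ∀ b → ⟦ b ⟧ + ⟦ not b ⟧ ≡ 1ℚ
    ⟦⟧+⟦not⟧ true  = refl
    ⟦⟧+⟦not⟧ false = refl

  countL≡0⇒false : ∀ (q : A → Bool) xs → countL q xs ≡ 0 → ∀ {x} → x ∈ xs → q x ≡ false
  countL≡0⇒false q (y ∷ xs) h x∈ with q y in qy
  countL≡0⇒false q (y ∷ xs) h (here refl) | false = qy
  countL≡0⇒false q (y ∷ xs) h (there x∈)  | false = countL≡0⇒false q xs h x∈

Sum-map : ∀ {A B : Set} (g : A → B) (xs : List A) (f : B → ℚ) → Sum (map g xs) f ≡ Sum xs (f ∘ g)
Sum-map g []       f = refl
Sum-map g (x ∷ xs) f = cong (f (g x) +_) (Sum-map g xs f)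

Sum-concat : ∀ {A : Set} (xss : List (List A)) (f : A → ℚ) → Sum (concat xss) f ≡ Sum xss (λ xs → Sum xs f)
Sum-concat []         f = refl
Sum-concat (xs ∷ xss) f = trans (Sum-++ xs (concat xss) f) (cong (Sum xs f +_) (Sum-concat xss f))

Sum-swap : ∀ {A B : Set} (xs : List A) (ys : List B) (f : A → B → ℚ) →
           Sum xs (λ x → Sum ys (f x)) ≡ Sum ys (λ y → Sum xs (λ x → f x y))
Sum-swap []       ys f = sym (Sum-zero ys (λ _ → refl))
Sum-swap (x ∷ xs) ys f = trans (cong (Sum ys (f x) +_) (Sum-swap xs ys f))
                               (sym (Sum-+ ys (f x) (λ y → Sum xs (λ x → f x y))))

Sum-allFin-suc : ∀ n (f : Fin (suc n) → ℚ) → Sum (allFin (suc n)) f ≡ f F.zero + Sum (allFin n) (f ∘ F.suc)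
Sum-allFin-suc n f = cong (f F.zero +_) (trans (cong (λ xs → Sum xs f) (sym (LP.map-tabulate id F.suc)))
                                               (Sum-map F.suc (allFin n) f))

Sum-allFin-select : ∀ n (j : Fin n) (f : Fin n → ℚ) → (∀ i → i ≢ j → f i ≡ 0ℚ) → Sum (allFin n) f ≡ f j
Sum-allFin-select (suc n) F.zero f f≡0 = begin
  Sum (allFin (suc n)) f                  ≡⟨ Sum-allFin-suc n f ⟩
  f F.zero + Sum (allFin n) (f ∘ F.suc)   ≡⟨ cong (f F.zero +_) (Sum-zero (allFin n) (λ {i} _ → f≡0 (F.suc i) (λ ()))) ⟩
  f F.zero + 0ℚ                           ≡⟨ ℚP.+-identityʳ _ ⟩
  f F.zero                                ∎
  where open ≡-Reasoning
Sum-allFin-select (suc n) (F.suc j) f f≡0 = begin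
  Sum (allFin (suc n)) f                  ≡⟨ Sum-allFin-suc n f ⟩
  f F.zero + Sum (allFin n) (f ∘ F.suc)   ≡⟨ cong₂ _+_ (f≡0 F.zero (λ ())) (Sum-allFin-select n j (f ∘ F.suc) f∘suc≡0) ⟩
  0ℚ + f (F.suc j)                        ≡⟨ ℚP.+-identityˡ _ ⟩
  f (F.suc j)                             ∎
  where
  open ≡-Reasoning
  f∘suc≡0 : ∀ i → i ≢ j → f (F.suc i) ≡ 0ℚ
  f∘suc≡0 i i≢j = f≡0 (F.suc i) (i≢j ∘ FP.suc-injective)

Sum-vecs-select : ∀ n k (w : Vec (Fin n) k) (f : Vec (Fin n) k → ℚ) → (∀ π → π ≢ w → f π ≡ 0ℚ) →
                  Sum (vecs n k) f ≡ f w
Sum-vecs-select n zero    []       f f≡0 = ℚP.+-identityʳ (f [])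
Sum-vecs-select n (suc k) (i ∷ w) f f≡0 = begin
  Sum (concat (map prefixed (allFin n))) f         ≡⟨ Sum-concat (map prefixed (allFin n)) f ⟩
  Sum (map prefixed (allFin n)) (λ πs → Sum πs f)  ≡⟨ Sum-map prefixed (allFin n) (λ πs → Sum πs f) ⟩
  Sum (allFin n) (λ j → Sum (prefixed j) f)        ≡⟨ Sum-cong (allFin n) (λ j → Sum-map (j ∷_) (vecs n k) f) ⟩
  Sum (allFin n) (λ j → Sum (vecs n k) (f ∘ (j ∷_))) ≡⟨ Sum-allFin-select n i _ other-head ⟩
  Sum (vecs n k) (f ∘ (i ∷_))                      ≡⟨ Sum-vecs-select n k w (f ∘ (i ∷_)) other-tail ⟩
  f (i ∷ w)                                        ∎
  where
  open ≡-Reasoning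
  prefixed : Fin n → List (Vec (Fin n) (suc k))
  prefixed j = map (j ∷_) (vecs n k)
  other-head : ∀ j → j ≢ i → Sum (vecs n k) (f ∘ (j ∷_)) ≡ 0ℚ
  other-head j j≢i = Sum-zero (vecs n k) (λ {π} _ → f≡0 (j ∷ π) (j≢i ∘ VP.∷-injectiveˡ))
  other-tail : ∀ π → π ≢ w → f (i ∷ π) ≡ 0ℚ
  other-tail π π≢w = f≡0 (i ∷ π) (π≢w ∘ VP.∷-injectiveʳ)

∨-true : ∀ {x y : Bool} → x ∨ y ≡ true → x ≡ true ⊎ y ≡ true
∨-true {true}          _ = inj₁ refl
∨-true {false} {true}  _ = inj₂ refl

false≢true : false ≢ true
false≢true ()

≡ᵇ⇒≡ : ∀ {i j} → (i ℕ.≡ᵇ j) ≡ true → i ≡ j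
≡ᵇ⇒≡ {i} {j} = ℕP.≡ᵇ⇒≡ i j ∘ Equivalence.from BP.T-≡

≡⇒≡ᵇ : ∀ {i j} → i ≡ j → (i ℕ.≡ᵇ j) ≡ true
≡⇒≡ᵇ {i} {j} = Equivalence.to BP.T-≡ ∘ ℕP.≡⇒≡ᵇ i j

<ᵇ⇒< : ∀ {i j} → (i ℕ.<ᵇ j) ≡ true → i < j
<ᵇ⇒< {i} {j} = ℕP.<ᵇ⇒< i j ∘ Equivalence.from BP.T-≡

<⇒<ᵇ : ∀ {i j} → i < j → (i ℕ.<ᵇ j) ≡ true
<⇒<ᵇ = Equivalence.to BP.T-≡ ∘ ℕP.<⇒<ᵇ

≟⇒≡ : ∀ {n} {u v : Fin n} → ⌊ u ≟ v ⌋ ≡ true → u ≡ v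
≟⇒≡ = toWitness ∘ Equivalence.from BP.T-≡

≡⇒≟ : ∀ {n} {u v : Fin n} → u ≡ v → ⌊ u ≟ v ⌋ ≡ true
≡⇒≟ {u = u} {v} = trans (isYes≗does (u ≟ v)) ∘ dec-true (u ≟ v)

≢⇒≟ : ∀ {n} {u v : Fin n} → u ≢ v → ⌊ u ≟ v ⌋ ≡ false
≢⇒≟ {u = u} {v} = trans (isYes≗does (u ≟ v)) ∘ dec-false (u ≟ v)

module _ {A : Set} (p : A → Bool) where

  allL : List A → Bool
  allL = foldr (λ x b → p x ∧ b) true

  anyL : List A → Bool
  anyL = foldr (λ x b → p x ∨ b) false

  allL-elim : ∀ xs → allL xs ≡ true → ∀ {x} → x ∈ xs → p x ≡ true
  allL-elim (y ∷ xs) h (here refl) = BP.∧-conicalˡ (p y) _ h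
  allL-elim (y ∷ xs) h (there x∈) = allL-elim xs (BP.∧-conicalʳ (p y) _ h) x∈

  allL-intro : ∀ xs → (∀ x → p x ≡ true) → allL xs ≡ true
  allL-intro []       h = refl
  allL-intro (y ∷ xs) h = cong₂ _∧_ (h y) (allL-intro xs h)

  allL-witness : ∀ xs → allL xs ≡ false → ∃[ x ] p x ≡ false
  allL-witness (y ∷ xs) h with p y in py
  ... | false = y , py
  ... | true  = allL-witness xs h

  anyL-elim : ∀ xs → anyL xs ≡ true → ∃[ x ] p x ≡ true
  anyL-elim (y ∷ xs) h with ∨-true {p y} h
  ... | inj₁ py = y , py
  ... | inj₂ h′ = anyL-elim xs h′

  anyL-intro : ∀ xs {x} → x ∈ xs → p x ≡ true → anyL xs ≡ true
  anyL-intro (y ∷ xs) (here refl) py = cong (_∨ anyL xs) py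
  anyL-intro (y ∷ xs) (there x∈)  px = trans (cong (p y ∨_) (anyL-intro xs x∈ px)) (BP.∨-zeroʳ (p y))

allL-cong : ∀ {A : Set} {p q : A → Bool} xs → (∀ x → p x ≡ q x) → allL p xs ≡ allL q xs
allL-cong []       p≡q = refl
allL-cong (x ∷ xs) p≡q = cong₂ _∧_ (p≡q x) (allL-cong xs p≡q)

module _ {n : ℕ} (p : Fin n → Bool) where

  allV-elim : allV p ≡ true → ∀ v → p v ≡ true
  allV-elim h v = allL-elim p (allFin n) h (∈-allFin v)

  allV-intro : (∀ v → p v ≡ true) → allV p ≡ true
  allV-intro = allL-intro p (allFin n)

  allV-false : ∀ v → p v ≡ false → allV p ≡ false
  allV-false v pv = BP.¬-not (λ h → false≢true (trans (sym pv) (allV-elim h v)))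

  allV-witness : allV p ≡ false → ∃[ v ] p v ≡ false
  allV-witness = allL-witness p (allFin n)

  anyV-elim : anyV p ≡ true → ∃[ v ] p v ≡ true
  anyV-elim = anyL-elim p (allFin n)

  anyV-intro : ∀ v → p v ≡ true → anyV p ≡ true
  anyV-intro v = anyL-intro p (allFin n) (∈-allFin v)

  anyV-false : (∀ v → p v ≡ false) → anyV p ≡ false
  anyV-false h = BP.¬-not (λ e → let (v , pv) = anyV-elim e in false≢true (trans (sym (h v)) pv))

allV-cong : ∀ {n} {p q : Fin n → Bool} → (∀ v → p v ≡ q v) → allV p ≡ allV q
allV-cong {n} = allL-cong (allFin n)

allV-suc : ∀ n (p : Fin (suc n) → Bool) → allV p ≡ p F.zero ∧ allV (p ∘ F.suc)
allV-suc n p = cong (p F.zero ∧_) (trans (cong (allL p) (sym (LP.map-tabulate id F.suc)))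
                                         (LP.foldr-map (λ v b → p v ∧ b) F.suc true (allFin n)))

-- Inclusion–exclusion over subsets

all₂ : ∀ {k} → (Bool → Bool → Bool) → Vec Bool k → Vec Bool k → Bool
all₂ f []       []       = true
all₂ f (x ∷ xs) (y ∷ ys) = f x y ∧ all₂ f xs ys

allV-lookup₂ : ∀ k (f : Bool → Bool → Bool) (xs ys : Vec Bool k) →
               allV (λ v → f (lookup xs v) (lookup ys v)) ≡ all₂ f xs ys
allV-lookup₂ zero    f []       []       = refl
allV-lookup₂ (suc k) f (x ∷ xs) (y ∷ ys) = trans (allV-suc k (λ v → f (lookup (x ∷ xs) v) (lookup (y ∷ ys) v)))
                                                 (cong (f x y ∧_) (allV-lookup₂ k f xs ys))

_⊆ᵇ_ : ∀ {k} → Vec Bool k → Vec Bool k → Bool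
_⊆ᵇ_ = all₂ (λ x y → not x ∨ y)

Disjointᵇ : ∀ {k} → Vec Bool k → Vec Bool k → Bool
Disjointᵇ = all₂ (λ x y → not (x ∧ y))

Sum-subsets-suc : ∀ k (f : Subset (suc k) → ℚ) →
                  Sum (subsets (suc k)) f ≡ Sum (subsets k) (f ∘ (false ∷_)) + Sum (subsets k) (f ∘ (true ∷_))
Sum-subsets-suc k f = trans (Sum-++ (map (false ∷_) (subsets k)) (map (true ∷_) (subsets k)) f)
                            (cong₂ _+_ (Sum-map (false ∷_) (subsets k) f) (Sum-map (true ∷_) (subsets k) f))

ie-term : ∀ {k} → Vec Bool k → Vec Bool k → Vec Bool k → ℚ
ie-term U B I = if I ⊆ᵇ U then sign ∣ I ∣ * ⟦ I ⊆ᵇ B ⟧ else 0ℚ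

inclusion-exclusion : ∀ k (U B : Vec Bool k) → Sum (subsets k) (ie-term U B) ≡ ⟦ Disjointᵇ U B ⟧
inclusion-exclusion zero    []       []       = refl
inclusion-exclusion (suc k) (u ∷ U) (c ∷ B) = begin
  Sum (subsets (suc k)) (ie-term (u ∷ U) (c ∷ B))
    ≡⟨ Sum-subsets-suc k (ie-term (u ∷ U) (c ∷ B)) ⟩
  Sum (subsets k) (ie-term U B) + Sum (subsets k) (ie-term (u ∷ U) (c ∷ B) ∘ (true ∷_))
    ≡⟨ cong (_+ Sum (subsets k) (ie-term (u ∷ U) (c ∷ B) ∘ (true ∷_))) (inclusion-exclusion k U B) ⟩
  ⟦ Disjointᵇ U B ⟧ + Sum (subsets k) (ie-term (u ∷ U) (c ∷ B) ∘ (true ∷_))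
    ≡⟨ with-head u c ⟩
  ⟦ Disjointᵇ (u ∷ U) (c ∷ B) ⟧ ∎
  where
  open ≡-Reasoning
  with-head : ∀ u c → ⟦ Disjointᵇ U B ⟧ + Sum (subsets k) (ie-term (u ∷ U) (c ∷ B) ∘ (true ∷_))
                      ≡ ⟦ Disjointᵇ (u ∷ U) (c ∷ B) ⟧
  with-head false c     = trans (cong (⟦ Disjointᵇ U B ⟧ +_) (Sum-zero (subsets k) (λ _ → refl))) (ℚP.+-identityʳ _)
  with-head true  false = trans (cong (⟦ Disjointᵇ U B ⟧ +_) (Sum-zero (subsets k) (λ {I} _ → vanishes I)))
                                (ℚP.+-identityʳ _)
    where
    vanishes : ∀ I → ie-term (true ∷ U) (false ∷ B) (true ∷ I) ≡ 0ℚ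
    vanishes I with I ⊆ᵇ U
    ... | true  = ℚP.*-zeroʳ (sign (suc ∣ I ∣))
    ... | false = refl
  with-head true  true  = begin
    ⟦ Disjointᵇ U B ⟧ + Sum (subsets k) (ie-term (true ∷ U) (true ∷ B) ∘ (true ∷_))
      ≡⟨ cong (⟦ Disjointᵇ U B ⟧ +_) (Sum-cong (subsets k) flips-sign) ⟩
    ⟦ Disjointᵇ U B ⟧ + Sum (subsets k) (λ I → - ie-term U B I)
      ≡⟨ cong (⟦ Disjointᵇ U B ⟧ +_) (Sum-neg (subsets k) (ie-term U B)) ⟩
    ⟦ Disjointᵇ U B ⟧ + - Sum (subsets k) (ie-term U B)
      ≡⟨ cong (λ s → ⟦ Disjointᵇ U B ⟧ + - s) (inclusion-exclusion k U B) ⟩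
    ⟦ Disjointᵇ U B ⟧ + - ⟦ Disjointᵇ U B ⟧
      ≡⟨ ℚP.+-inverseʳ ⟦ Disjointᵇ U B ⟧ ⟩
    0ℚ ∎
    where
    flips-sign : ∀ I → ie-term (true ∷ U) (true ∷ B) (true ∷ I) ≡ - ie-term U B I
    flips-sign I with I ⊆ᵇ U
    ... | true  = sym (ℚP.neg-distribˡ-* (sign ∣ I ∣) ⟦ I ⊆ᵇ B ⟧)
    ... | false = refl

lookup-false⇒∣∣≡0 : ∀ {k} (I : Subset k) → (∀ v → lookup I v ≡ false) → ∣ I ∣ ≡ 0
lookup-false⇒∣∣≡0 []      h = refl
lookup-false⇒∣∣≡0 (x ∷ I) h rewrite h F.zero = lookup-false⇒∣∣≡0 I (h ∘ F.suc)

∣∣-remove : ∀ {k} (I : Subset k) v → lookup I v ≡ true → suc ∣ I [ v ]≔ false ∣ ≡ ∣ I ∣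
∣∣-remove (true  ∷ I) F.zero    h = refl
∣∣-remove (false ∷ I) (F.suc v) h = ∣∣-remove I v h
∣∣-remove (true  ∷ I) (F.suc v) h = cong suc (∣∣-remove I v h)

-- Bijections and their prefixes

module Bijections (m : ℕ) where

  N : ℕ
  N = suc m

  Perm : Set
  Perm = Vec (Fin N) N

  rank : Perm → Fin N → ℕ
  rank π v = toℕ (lookup π v)

  ∈bijections⇒injective : ∀ {π} → π ∈ bijections N → injective π ≡ true
  ∈bijections⇒injective π∈ = Equivalence.to BP.T-≡ (proj₂ (∈-filter⁻ (B.T? ∘ injective) {xs = vecs N N} π∈))

  module _ {π : Perm} (π-inj : injective π ≡ true) where

    lookup-injective : ∀ {u v} → lookup π u ≡ lookup π v → u ≡ v
    lookup-injective {u} {v} πu≡πv = decide (allV-elim _ (allV-elim _ π-inj u) v)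
      where
      decide : not ⌊ lookup π u ≟ lookup π v ⌋ ∨ ⌊ u ≟ v ⌋ ≡ true → u ≡ v
      decide h with lookup π u ≟ lookup π v | u ≟ v
      ... | _        | yes u≡v = u≡v
      ... | no πu≢πv | no _    = ⊥-elim (πu≢πv πu≡πv)

    rank-injective : ∀ {u v} → rank π u ≡ rank π v → u ≡ v
    rank-injective = lookup-injective ∘ FP.toℕ-injective

    lookup-surjective : ∀ y → ∃[ x ] lookup π x ≡ y
    lookup-surjective y with FP.any? (λ x → lookup π x ≟ y)
    ... | yes hit = hit
    ... | no miss = ⊥-elim (ℕP.1+n≰n (FP.injective⇒≤ {f = squeeze} squeeze-injective))
      where
      squeeze : Fin N → Fin m
      squeeze x = F.punchOut {i = y} {j = lookup π x} (λ y≡πx → miss (x , sym y≡πx))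
      squeeze-injective : ∀ {x₁ x₂} → squeeze x₁ ≡ squeeze x₂ → x₁ ≡ x₂
      squeeze-injective = lookup-injective ∘ FP.punchOut-injective {i = y} _ _

    Sum-rank≡ : ∀ d → d < N → Sum (allFin N) (λ x → ⟦ rank π x ℕ.≡ᵇ d ⟧) ≡ 1ℚ
    Sum-rank≡ d d<N with lookup-surjective (F.fromℕ< d<N)
    ... | x , πx≡d = trans (Sum-allFin-select N x _ others) (cong ⟦_⟧ (≡⇒≡ᵇ rank-x))
      where
      rank-x : rank π x ≡ d
      rank-x = trans (cong toℕ πx≡d) (FP.toℕ-fromℕ< d<N)
      others : ∀ i → i ≢ x → ⟦ rank π i ℕ.≡ᵇ d ⟧ ≡ 0ℚ
      others i i≢x with rank π i ℕ.≡ᵇ d in eq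
      ... | false = refl
      ... | true  = ⊥-elim (i≢x (rank-injective (trans (≡ᵇ⇒≡ eq) (sym rank-x))))

  _∈ᵇ_ : Fin N → List (Fin N) → Bool
  v ∈ᵇ []      = false
  v ∈ᵇ (x ∷ p) = ⌊ v ≟ x ⌋ ∨ v ∈ᵇ p

  Distinct : List (Fin N) → Set
  Distinct []      = ⊤
  Distinct (x ∷ p) = x ∈ᵇ p ≡ false × Distinct p

  -- p lists the first vertices of π in reverse order: its head is the vertex of rank length p ∸ 1.
  Prefix : List (Fin N) → Perm → Bool
  Prefix []      π = true
  Prefix (x ∷ p) π = (rank π x ℕ.≡ᵇ length p) ∧ Prefix p π

  ΣExt : List (Fin N) → (Perm → ℚ) → ℚ
  ΣExt p g = Sum (bijections N) (λ π → ⟦ Prefix p π ⟧ * g π)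

  rank-outside : ∀ p {π} → injective π ≡ true → Prefix p π ≡ true →
                 ∀ {v} → v ∈ᵇ p ≡ false → length p ≤ rank π v
  rank-outside []      π-inj pre v∉ = z≤n
  rank-outside (x ∷ p) {π} π-inj pre {v} v∉ =
    ℕP.≤∧≢⇒< (rank-outside p π-inj (BP.∧-conicalʳ _ _ pre) (BP.∨-conicalʳ _ _ v∉))
             (λ p≡v → v≢x (rank-injective {π} π-inj (trans (sym p≡v) (sym rank-x))))
    where
    rank-x : rank π x ≡ length p
    rank-x = ≡ᵇ⇒≡ (BP.∧-conicalˡ _ _ pre)
    v≢x : v ≢ x
    v≢x v≡x = false≢true (trans (sym (BP.∨-conicalˡ _ _ v∉)) (≡⇒≟ v≡x))

  rank-inside : ∀ p {π} → Prefix p π ≡ true → ∀ {v} → v ∈ᵇ p ≡ true → rank π v < length p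
  rank-inside (x ∷ p) {π} pre {v} v∈ with ∨-true {⌊ v ≟ x ⌋} v∈
  ... | inj₁ v≡x rewrite ≟⇒≡ v≡x = ℕP.≤-reflexive (cong suc (≡ᵇ⇒≡ (BP.∧-conicalˡ _ _ pre)))
  ... | inj₂ v∈p = ℕP.m≤n⇒m≤1+n (rank-inside p (BP.∧-conicalʳ _ _ pre) v∈p)

  Prefix-repeat : ∀ x p π → x ∈ᵇ p ≡ true → Prefix (x ∷ p) π ≡ false
  Prefix-repeat x p π x∈p = BP.¬-not (λ pre →
    ℕP.<-irrefl (≡ᵇ⇒≡ (BP.∧-conicalˡ _ _ pre)) (rank-inside p (BP.∧-conicalʳ _ _ pre) x∈p))

  ΣExt-split : ∀ p g → length p < N → ΣExt p g ≡ Sum (allFin N) (λ x → ΣExt (x ∷ p) g)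
  ΣExt-split p g p<N = trans (Sum-cong-∈ (bijections N) (λ π∈ → sym (split (∈bijections⇒injective π∈))))
                             (Sum-swap (bijections N) (allFin N) (λ π x → ⟦ Prefix (x ∷ p) π ⟧ * g π))
    where
    split : ∀ {π} → injective π ≡ true →
            Sum (allFin N) (λ x → ⟦ Prefix (x ∷ p) π ⟧ * g π) ≡ ⟦ Prefix p π ⟧ * g π
    split {π} π-inj = begin
      Sum (allFin N) (λ x → ⟦ (rank π x ℕ.≡ᵇ length p) ∧ Prefix p π ⟧ * g π)
        ≡⟨ Sum-cong (allFin N) (λ x → trans (cong (_* g π) (⟦∧⟧ (rank π x ℕ.≡ᵇ length p) (Prefix p π)))
                                            (ℚP.*-assoc ⟦ rank π x ℕ.≡ᵇ length p ⟧ ⟦ Prefix p π ⟧ (g π))) ⟩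
      Sum (allFin N) (λ x → ⟦ rank π x ℕ.≡ᵇ length p ⟧ * (⟦ Prefix p π ⟧ * g π))
        ≡⟨ Sum-*ʳ (allFin N) (⟦ Prefix p π ⟧ * g π) (λ x → ⟦ rank π x ℕ.≡ᵇ length p ⟧) ⟩
      Sum (allFin N) (λ x → ⟦ rank π x ℕ.≡ᵇ length p ⟧) * (⟦ Prefix p π ⟧ * g π)
        ≡⟨ cong (_* (⟦ Prefix p π ⟧ * g π)) (Sum-rank≡ {π} π-inj (length p) p<N) ⟩
      1ℚ * (⟦ Prefix p π ⟧ * g π)
        ≡⟨ ℚP.*-identityˡ _ ⟩
      ⟦ Prefix p π ⟧ * g π ∎
      where open ≡-Reasoning

  ΣExt-cong : ∀ p {h₁ h₂ : Perm → Bool} → (∀ {π} → injective π ≡ true → Prefix p π ≡ true → h₁ π ≡ h₂ π) →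
              ΣExt p (λ π → ⟦ h₁ π ⟧) ≡ ΣExt p (λ π → ⟦ h₂ π ⟧)
  ΣExt-cong p {h₁} {h₂} h₁≡h₂ = Sum-cong-∈ (bijections N) pointwise
    where
    pointwise : ∀ {π} → π ∈ bijections N → ⟦ Prefix p π ⟧ * ⟦ h₁ π ⟧ ≡ ⟦ Prefix p π ⟧ * ⟦ h₂ π ⟧
    pointwise {π} π∈ with Prefix p π in pre
    ... | false = trans (ℚP.*-zeroˡ ⟦ h₁ π ⟧) (sym (ℚP.*-zeroˡ ⟦ h₂ π ⟧))
    ... | true  = cong (λ b → 1ℚ * ⟦ b ⟧) (h₁≡h₂ (∈bijections⇒injective π∈) pre)

  ΣExt-zero : ∀ p {h : Perm → Bool} → (∀ {π} → injective π ≡ true → Prefix p π ≡ true → h π ≡ false) →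
              ΣExt p (λ π → ⟦ h π ⟧) ≡ 0ℚ
  ΣExt-zero p h≡false = trans (ΣExt-cong p h≡false) (Sum-zero (bijections N) (λ {π} _ → ℚP.*-zeroʳ ⟦ Prefix p π ⟧))

  Sum-∈ᵇ : ∀ p → Distinct p → Sum (allFin N) (λ v → ⟦ v ∈ᵇ p ⟧) ≡ fromℕ (length p)
  Sum-∈ᵇ []      _                  = Sum-zero (allFin N) (λ _ → refl)
  Sum-∈ᵇ (x ∷ p) (x∉p , distinct) = begin
    Sum (allFin N) (λ v → ⟦ ⌊ v ≟ x ⌋ ∨ v ∈ᵇ p ⟧)
      ≡⟨ Sum-cong (allFin N) split ⟩
    Sum (allFin N) (λ v → ⟦ ⌊ v ≟ x ⌋ ⟧ + ⟦ v ∈ᵇ p ⟧)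
      ≡⟨ Sum-+ (allFin N) (λ v → ⟦ ⌊ v ≟ x ⌋ ⟧) (λ v → ⟦ v ∈ᵇ p ⟧) ⟩
    Sum (allFin N) (λ v → ⟦ ⌊ v ≟ x ⌋ ⟧) + Sum (allFin N) (λ v → ⟦ v ∈ᵇ p ⟧)
      ≡⟨ cong₂ _+_ just-x (Sum-∈ᵇ p distinct) ⟩
    1ℚ + fromℕ (length p)
      ≡⟨ fromℕ-+ 1 (length p) ⟨
    fromℕ (suc (length p)) ∎
    where
    open ≡-Reasoning
    split : ∀ v → ⟦ ⌊ v ≟ x ⌋ ∨ v ∈ᵇ p ⟧ ≡ ⟦ ⌊ v ≟ x ⌋ ⟧ + ⟦ v ∈ᵇ p ⟧
    split v with v ≟ x
    ... | yes refl rewrite x∉p = refl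
    ... | no _ = sym (ℚP.+-identityˡ _)
    just-x : Sum (allFin N) (λ v → ⟦ ⌊ v ≟ x ⌋ ⟧) ≡ 1ℚ
    just-x = trans (Sum-allFin-select N x _ (λ v v≢x → cong ⟦_⟧ (≢⇒≟ v≢x))) (cong ⟦_⟧ (≡⇒≟ {u = x} refl))

  Sum-∉ᵇ : ∀ p r → Distinct p → length p ℕ.+ r ≡ N → Sum (allFin N) (λ v → ⟦ not (v ∈ᵇ p) ⟧) ≡ fromℕ r
  Sum-∉ᵇ p r distinct p+r≡N = +-cancelˡ (fromℕ (length p)) _ _ (begin
    fromℕ (length p) + outside
      ≡⟨ cong (_+ outside) (Sum-∈ᵇ p distinct) ⟨
    Sum (allFin N) (λ v → ⟦ v ∈ᵇ p ⟧) + outside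
      ≡⟨ Sum-⟦⟧+Sum-⟦not⟧ (_∈ᵇ p) (allFin N) ⟩
    fromℕ (length (allFin N))
      ≡⟨ cong fromℕ (trans (LP.length-tabulate id) (sym p+r≡N)) ⟩
    fromℕ (length p ℕ.+ r)
      ≡⟨ fromℕ-+ (length p) r ⟩
    fromℕ (length p) + fromℕ r ∎)
    where
    open ≡-Reasoning
    outside : ℚ
    outside = Sum (allFin N) (λ v → ⟦ not (v ∈ᵇ p) ⟧)

  position : List (Fin N) → Fin N → ℕ
  position []      v = 0
  position (x ∷ p) v = if ⌊ v ≟ x ⌋ then length p else position p v

  position<length : ∀ p {v} → v ∈ᵇ p ≡ true → position p v < length p
  position<length (x ∷ p) {v} v∈ with v ≟ x
  ... | yes _ = ℕP.n<1+n (length p)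
  ... | no _  = ℕP.m<n⇒m<1+n (position<length p v∈)

  Prefix⇒rank≡position : ∀ p {π} → Prefix p π ≡ true → ∀ {v} → v ∈ᵇ p ≡ true → rank π v ≡ position p v
  Prefix⇒rank≡position (x ∷ p) pre {v} v∈ with v ≟ x
  ... | yes refl = ≡ᵇ⇒≡ (BP.∧-conicalˡ _ _ pre)
  ... | no _     = Prefix⇒rank≡position p (BP.∧-conicalʳ _ _ pre) v∈

  rank≡position⇒Prefix : ∀ p {π} → Distinct p → (∀ {v} → v ∈ᵇ p ≡ true → rank π v ≡ position p v) →
                         Prefix p π ≡ true
  rank≡position⇒Prefix []      _                  _     = refl
  rank≡position⇒Prefix (x ∷ p) {π} (x∉p , distinct) rank≡ =
    cong₂ _∧_ (≡⇒≡ᵇ rank-x) (rank≡position⇒Prefix p distinct rank≡′)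
    where
    x≟x : ⌊ x ≟ x ⌋ ≡ true
    x≟x = ≡⇒≟ refl
    rank-x : rank π x ≡ length p
    rank-x = trans (rank≡ (cong (_∨ x ∈ᵇ p) x≟x)) (cong (λ b → if b then length p else position p x) x≟x)
    rank≡′ : ∀ {v} → v ∈ᵇ p ≡ true → rank π v ≡ position p v
    rank≡′ {v} v∈p = trans (rank≡ (trans (cong (⌊ v ≟ x ⌋ ∨_) v∈p) (BP.∨-zeroʳ _)))
                           (cong (λ b → if b then length p else position p v) (≢⇒≟ v≢x))
      where
      v≢x : v ≢ x
      v≢x refl = false≢true (trans (sym x∉p) v∈p)

  position-injective : ∀ p → Distinct p → ∀ {u v} → u ∈ᵇ p ≡ true → v ∈ᵇ p ≡ true →
                       position p u ≡ position p v → u ≡ v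
  position-injective (x ∷ p) (x∉p , distinct) {u} {v} u∈ v∈ eq with u ≟ x | v ≟ x
  ... | yes refl | yes refl = refl
  ... | yes refl | no _     = ⊥-elim (ℕP.<-irrefl (sym eq) (position<length p v∈))
  ... | no _     | yes refl = ⊥-elim (ℕP.<-irrefl eq (position<length p u∈))
  ... | no _     | no _     = position-injective p distinct u∈ v∈ eq

  module _ {p : List (Fin N)} (distinct : Distinct p) (full : length p ≡ N) where

    covers : ∀ v → v ∈ᵇ p ≡ true
    covers v = BP.not-injective (countL≡0⇒false (λ u → not (u ∈ᵇ p)) (allFin N) none-outside (∈-allFin v))
      where
      none-outside : countL (λ u → not (u ∈ᵇ p)) (allFin N) ≡ 0
      none-outside = fromℕ-injective (trans (fromℕ-countL (λ u → not (u ∈ᵇ p)) (allFin N))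
                                            (Sum-∉ᵇ p 0 distinct (trans (ℕP.+-identityʳ (length p)) full)))

    prefixPerm : Perm
    prefixPerm = tabulate (λ v → position p v mod N)

    rank-prefixPerm : ∀ v → rank prefixPerm v ≡ position p v
    rank-prefixPerm v = begin
      toℕ (lookup prefixPerm v)  ≡⟨ cong toℕ (VP.lookup∘tabulate (λ u → position p u mod N) v) ⟩
      toℕ (position p v mod N)   ≡⟨ FP.toℕ-fromℕ< _ ⟩
      position p v ℕ.% N         ≡⟨ m<n⇒m%n≡m (subst (position p v <_) full (position<length p (covers v))) ⟩
      position p v               ∎
      where open ≡-Reasoning

    prefixPerm-injective : injective prefixPerm ≡ true
    prefixPerm-injective = allV-intro _ (λ u → allV-intro _ (distinct-values u))
      where
      distinct-values : ∀ u v → not ⌊ lookup prefixPerm u ≟ lookup prefixPerm v ⌋ ∨ ⌊ u ≟ v ⌋ ≡ true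
      distinct-values u v with lookup prefixPerm u ≟ lookup prefixPerm v
      ... | no _      = refl
      ... | yes πu≡πv = ≡⇒≟ (position-injective p distinct (covers u) (covers v)
                              (trans (sym (rank-prefixPerm u)) (trans (cong toℕ πu≡πv) (rank-prefixPerm v))))

    Prefix⇒≡prefixPerm : ∀ {π} → Prefix p π ≡ true → π ≡ prefixPerm
    Prefix⇒≡prefixPerm {π} pre = trans (sym (VP.tabulate∘lookup π))
                                      (trans (VP.tabulate-cong same-values) (VP.tabulate∘lookup prefixPerm))
      where
      same-values : ∀ v → lookup π v ≡ lookup prefixPerm v
      same-values v = FP.toℕ-injective (trans (Prefix⇒rank≡position p pre (covers v)) (sym (rank-prefixPerm v)))

    ΣExt-full : ΣExt p (λ _ → 1ℚ) ≡ 1ℚ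
    ΣExt-full = begin
      Sum (filter (B.T? ∘ injective) (vecs N N)) (λ π → ⟦ Prefix p π ⟧ * 1ℚ)
        ≡⟨ Sum-filter (vecs N N) injective (λ π → ⟦ Prefix p π ⟧ * 1ℚ) ⟩
      Sum (vecs N N) term
        ≡⟨ Sum-vecs-select N N prefixPerm term others ⟩
      term prefixPerm
        ≡⟨ cong₂ (λ i b → if i then ⟦ b ⟧ * 1ℚ else 0ℚ) prefixPerm-injective
                 (rank≡position⇒Prefix p distinct (λ {v} _ → rank-prefixPerm v)) ⟩
      1ℚ * 1ℚ
        ≡⟨ ℚP.*-identityˡ 1ℚ ⟩
      1ℚ ∎
      where
      open ≡-Reasoning
      term : Perm → ℚ
      term π = if injective π then ⟦ Prefix p π ⟧ * 1ℚ else 0ℚ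
      others : ∀ π → π ≢ prefixPerm → term π ≡ 0ℚ
      others π π≢ with injective π | Prefix p π in pre
      ... | false | _     = refl
      ... | true  | false = ℚP.*-zeroˡ 1ℚ
      ... | true  | true  = ⊥-elim (π≢ (Prefix⇒≡prefixPerm pre))

  length<N : ∀ (p : List (Fin N)) {r} → length p ℕ.+ suc r ≡ N → length p < N
  length<N p p+r≡N = subst (length p <_) p+r≡N (ℕP.m<m+n (length p) (s≤s z≤n))

  ΣExt-one : ∀ r p → Distinct p → length p ℕ.+ r ≡ N → ΣExt p (λ _ → 1ℚ) ≡ fromℕ (r !)
  ΣExt-one zero    p distinct p+0≡N = ΣExt-full distinct (trans (sym (ℕP.+-identityʳ (length p))) p+0≡N)
  ΣExt-one (suc r) p distinct p+r≡N = begin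
    ΣExt p (λ _ → 1ℚ)
      ≡⟨ ΣExt-split p (λ _ → 1ℚ) (length<N p p+r≡N) ⟩
    Sum (allFin N) (λ x → ΣExt (x ∷ p) (λ _ → 1ℚ))
      ≡⟨ Sum-cong (allFin N) next ⟩
    Sum (allFin N) (λ x → ⟦ not (x ∈ᵇ p) ⟧ * fromℕ (r !))
      ≡⟨ Sum-*ʳ (allFin N) (fromℕ (r !)) (λ x → ⟦ not (x ∈ᵇ p) ⟧) ⟩
    Sum (allFin N) (λ x → ⟦ not (x ∈ᵇ p) ⟧) * fromℕ (r !)
      ≡⟨ cong (_* fromℕ (r !)) (Sum-∉ᵇ p (suc r) distinct p+r≡N) ⟩
    fromℕ (suc r) * fromℕ (r !)
      ≡⟨ fromℕ-* (suc r) (r !) ⟨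
    fromℕ (suc r !) ∎
    where
    open ≡-Reasoning
    next : ∀ x → ΣExt (x ∷ p) (λ _ → 1ℚ) ≡ ⟦ not (x ∈ᵇ p) ⟧ * fromℕ (r !)
    next x with x ∈ᵇ p in x∈p
    ... | true  = trans (Sum-zero (bijections N) (λ {π} _ → trans (cong (λ c → ⟦ c ⟧ * 1ℚ) (Prefix-repeat x p π x∈p))
                                                                  (ℚP.*-zeroˡ 1ℚ)))
                        (sym (ℚP.*-zeroˡ (fromℕ (r !))))
    ... | false = trans (ΣExt-one r (x ∷ p) (x∈p , distinct) (trans (sym (ℕP.+-suc (length p) r)) p+r≡N))
                        (sym (ℚP.*-identityˡ (fromℕ (r !))))

  length-bijections : length (bijections N) ≡ N !
  length-bijections = fromℕ-injective (trans (sym (Sum-one (bijections N))) (ΣExt-one N [] tt refl))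

  m!*inv-length : fromℕ (m !) * inv (length (bijections N)) ≡ inv N
  m!*inv-length = begin
    fromℕ (m !) * inv (length (bijections N))
      ≡⟨ cong (λ k → fromℕ (m !) * inv k) length-bijections ⟩
    fromℕ (m !) * inv (N !)
      ≡⟨ ℚP.*-identityˡ _ ⟨
    1ℚ * (fromℕ (m !) * inv (N !))
      ≡⟨ cong (_* (fromℕ (m !) * inv (N !))) (fromℕ*inv N) ⟨
    fromℕ N * inv N * (fromℕ (m !) * inv (N !))
      ≡⟨ solve 4 (λ n i f j → n :* i :* (f :* j) := n :* f :* j :* i) refl
                 (fromℕ N) (inv N) (fromℕ (m !)) (inv (N !)) ⟩
    fromℕ N * fromℕ (m !) * inv (N !) * inv N
      ≡⟨ cong (λ z → z * inv (N !) * inv N) (fromℕ-* N (m !)) ⟨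
    fromℕ (N !) * inv (N !) * inv N
      ≡⟨ cong (_* inv N) (fromℕ*inv (N !) {{N ℕP.!≢0}}) ⟩
    1ℚ * inv N
      ≡⟨ ℚP.*-identityˡ (inv N) ⟩
    inv N ∎
    where
    open ≡-Reasoning
    open +-*-Solver using (solve; _:*_; _:=_)

-- Local minima of a random ranking

module _ {m : ℕ} (G : Graph (suc m)) where
  open Bijections m

  _∈N[_] : Fin N → Subset N → Bool
  v ∈N[ I ] = inClosedNbhd G I v

  _∖_ : Subset N → Fin N → Subset N
  I ∖ x = I [ x ]≔ false

  mem-∖-self : ∀ I x → mem (I ∖ x) x ≡ false
  mem-∖-self I x = VP.lookup∘update x I false

  mem-∖-other : ∀ I {x v} → v ≢ x → mem (I ∖ x) v ≡ mem I v
  mem-∖-other I v≢x = VP.lookup∘update′ v≢x I false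

  mem-∖⇒mem : ∀ I x {v} → mem (I ∖ x) v ≡ true → mem I v ≡ true
  mem-∖⇒mem I x {v} v∈ with v ≟ x
  ... | yes refl = ⊥-elim (false≢true (trans (sym (mem-∖-self I v)) v∈))
  ... | no v≢x   = trans (sym (mem-∖-other I v≢x)) v∈

  mem⇒∈N : ∀ I {v} → mem I v ≡ true → v ∈N[ I ] ≡ true
  mem⇒∈N I {v} v∈ = cong (_∨ anyV (λ u → mem I u ∧ adj G u v)) v∈

  adj⇒∈N : ∀ I {u v} → mem I u ≡ true → adj G u v ≡ true → v ∈N[ I ] ≡ true
  adj⇒∈N I {u} {v} u∈ uv = trans (cong (mem I v ∨_) (anyV-intro (λ w → mem I w ∧ adj G w v) u (cong₂ _∧_ u∈ uv)))
                                 (BP.∨-zeroʳ (mem I v))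

  ∈N-elim : ∀ I {v} → v ∈N[ I ] ≡ true → mem I v ≡ true ⊎ ∃[ u ] (mem I u ≡ true × adj G u v ≡ true)
  ∈N-elim I {v} v∈N with ∨-true {mem I v} v∈N
  ... | inj₁ v∈  = inj₁ v∈
  ... | inj₂ nbr = let (u , u∈∧uv) = anyV-elim (λ w → mem I w ∧ adj G w v) nbr
                   in inj₂ (u , BP.∧-conicalˡ _ _ u∈∧uv , BP.∧-conicalʳ _ _ u∈∧uv)

  ∈N-∖ : ∀ I x {v} → v ∈N[ I ∖ x ] ≡ true → v ∈N[ I ] ≡ true
  ∈N-∖ I x v∈N with ∈N-elim (I ∖ x) v∈N
  ... | inj₁ v∈             = mem⇒∈N I (mem-∖⇒mem I x v∈)
  ... | inj₂ (u , u∈ , uv) = adj⇒∈N I (mem-∖⇒mem I x u∈) uv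

  adj⇒≢ : ∀ {u v} → adj G u v ≡ true → u ≢ v
  adj⇒≢ {u} uv refl = false≢true (trans (sym (irrefl G u)) uv)

  independent-elim : ∀ I → independent G I ≡ true → ∀ {u v} → mem I u ≡ true → mem I v ≡ true → adj G u v ≡ false
  independent-elim I indep {u} {v} u∈ v∈ = not-edge (allV-elim _ (allV-elim _ indep u) v)
    where
    not-edge : not (mem I u ∧ mem I v ∧ adj G u v) ≡ true → adj G u v ≡ false
    not-edge h rewrite u∈ | v∈ = BP.not-injective h

  independent-∖ : ∀ I x → independent G I ≡ true → independent G (I ∖ x) ≡ true
  independent-∖ I x indep = allV-intro _ (λ u → allV-intro _ (no-edge u))
    where
    no-edge : ∀ u v → not (mem (I ∖ x) u ∧ mem (I ∖ x) v ∧ adj G u v) ≡ true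
    no-edge u v with mem (I ∖ x) u in u∈ | mem (I ∖ x) v in v∈
    ... | false | _     = refl
    ... | true  | false = refl
    ... | true  | true  rewrite independent-elim I indep (mem-∖⇒mem I x u∈) (mem-∖⇒mem I x v∈) = refl

  a≤N : ∀ I → a G I ≤ N
  a≤N I = subst (a G I ≤_) (LP.length-tabulate id) (LP.length-filter (B.T? ∘ (λ v → not (v ∈N[ I ]))) (allFin N))

  fromℕ-N∸a : ∀ I → fromℕ (N ∸ a G I) ≡ Sum (allFin N) (λ v → ⟦ v ∈N[ I ] ⟧)
  fromℕ-N∸a I = +-cancelˡ (fromℕ (a G I)) _ _ (begin
    fromℕ (a G I) + fromℕ (N ∸ a G I)  ≡⟨ fromℕ-+ (a G I) (N ∸ a G I) ⟨
    fromℕ (a G I ℕ.+ (N ∸ a G I))      ≡⟨ cong fromℕ (trans (ℕP.m+[n∸m]≡n (a≤N I)) (sym (LP.length-tabulate id))) ⟩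
    fromℕ (length (allFin N))          ≡⟨ Sum-⟦⟧+Sum-⟦not⟧ (_∈N[ I ]) (allFin N) ⟨
    inside + outside                   ≡⟨ ℚP.+-comm inside outside ⟩
    outside + inside                   ≡⟨ cong (_+ inside) (fromℕ-countL (λ v → not (v ∈N[ I ])) (allFin N)) ⟨
    fromℕ (a G I) + inside             ∎)
    where
    open ≡-Reasoning
    inside outside : ℚ
    inside  = Sum (allFin N) (λ v → ⟦ v ∈N[ I ] ⟧)
    outside = Sum (allFin N) (λ v → ⟦ not (v ∈N[ I ]) ⟧)

  N∸a-nonZero : ∀ I {v} → mem I v ≡ true → NonZero (N ∸ a G I)
  N∸a-nonZero I {v} v∈ = ℕ.≢-nonZero (λ N∸a≡0 → false≢true (trans (sym (v∉N N∸a≡0)) (mem⇒∈N I v∈)))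
    where
    v∉N : N ∸ a G I ≡ 0 → v ∈N[ I ] ≡ false
    v∉N N∸a≡0 = countL≡0⇒false (_∈N[ I ]) (allFin N)
      (fromℕ-injective (trans (fromℕ-countL (_∈N[ I ]) (allFin N)) (trans (sym (fromℕ-N∸a I)) (cong fromℕ N∸a≡0))))
      (∈-allFin v)

  Σb∖ : Subset N → ℚ
  Σb∖ I = Sum (allFin N) (λ v → if mem I v then b G (I ∖ v) else 0ℚ)

  b-unfold : ∀ I {v} → mem I v ≡ true → b G I ≡ inv (N ∸ a G I) * Σb∖ I
  b-unfold I {v} v∈ = begin
    bAux G ∣ I ∣ I
      ≡⟨ cong (λ k → bAux G k I) size ⟨
    bAux G (suc k) I
      ≡⟨ cong (λ c → if c then unfolded else 1ℚ) (anyV-intro (mem I) v v∈) ⟩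
    unfolded
      ≡⟨ cong (inv (N ∸ a G I) *_) (Sum-cong (allFin N) sizes) ⟩
    inv (N ∸ a G I) * Σb∖ I ∎
    where
    open ≡-Reasoning
    k : ℕ
    k = ∣ I ∖ v ∣
    size : suc k ≡ ∣ I ∣
    size = ∣∣-remove I v v∈
    unfolded : ℚ
    unfolded = inv (N ∸ a G I) * Sum (allFin N) (λ u → if mem I u then bAux G k (I ∖ u) else 0ℚ)
    sizes : ∀ u → (if mem I u then bAux G k (I ∖ u) else 0ℚ) ≡ (if mem I u then b G (I ∖ u) else 0ℚ)
    sizes u with mem I u in u∈
    ... | false = refl
    ... | true  = cong (λ j → bAux G j (I ∖ u)) (ℕP.suc-injective (trans size (sym (∣∣-remove I u u∈))))

  b-recurrence : ∀ I → Σb∖ I ≡ fromℕ (N ∸ a G I) * b G I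
  b-recurrence I = by-cases (FP.any? (λ v → mem I v B.≟ true))
    where
    open ≡-Reasoning
    by-cases : Dec (∃[ v ] mem I v ≡ true) → Σb∖ I ≡ fromℕ (N ∸ a G I) * b G I
    by-cases (yes (v , v∈)) = sym (begin
      fromℕ (N ∸ a G I) * b G I
        ≡⟨ cong (fromℕ (N ∸ a G I) *_) (b-unfold I v∈) ⟩
      fromℕ (N ∸ a G I) * (inv (N ∸ a G I) * Σb∖ I)
        ≡⟨ ℚP.*-assoc (fromℕ (N ∸ a G I)) (inv (N ∸ a G I)) (Σb∖ I) ⟨
      fromℕ (N ∸ a G I) * inv (N ∸ a G I) * Σb∖ I
        ≡⟨ cong (_* Σb∖ I) (fromℕ*inv (N ∸ a G I) {{N∸a-nonZero I v∈}}) ⟩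
      1ℚ * Σb∖ I
        ≡⟨ ℚP.*-identityˡ (Σb∖ I) ⟩
      Σb∖ I ∎)
    by-cases (no empty) = begin
      Σb∖ I
        ≡⟨ Sum-zero (allFin N) (λ {v} _ → cong (λ c → if c then b G (I ∖ v) else 0ℚ) (∉I v)) ⟩
      0ℚ
        ≡⟨ ℚP.*-zeroˡ (b G I) ⟨
      0ℚ * b G I
        ≡⟨ cong (_* b G I) (Sum-zero (allFin N) (λ {v} _ → cong ⟦_⟧ (∉N v))) ⟨
      Sum (allFin N) (λ v → ⟦ v ∈N[ I ] ⟧) * b G I
        ≡⟨ cong (_* b G I) (fromℕ-N∸a I) ⟨
      fromℕ (N ∸ a G I) * b G I ∎
      where
      ∉I : ∀ v → mem I v ≡ false
      ∉I v = BP.¬-not (λ v∈ → empty (v , v∈))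
      ∉N : ∀ v → v ∈N[ I ] ≡ false
      ∉N v = cong₂ _∨_ (∉I v) (anyV-false _ (λ u → cong (_∧ adj G u v) (∉I u)))

  hasLowerNeighbour : Perm → Fin N → Bool
  hasLowerNeighbour π v = anyV (λ u → adj G u v ∧ (rank π u ℕ.<ᵇ rank π v))

  LocalMinima : Subset N → Perm → Bool
  LocalMinima I π = allV (λ v → not (mem I v) ∨ not (hasLowerNeighbour π v))

  Fails : Subset N → Perm → Bool
  Fails I π = allV (λ v → not (mem I v) ∨ not (Gv G π v))

  Avoids : Subset N → List (Fin N) → Set
  Avoids I p = ∀ {v} → v ∈N[ I ] ≡ true → v ∈ᵇ p ≡ false

  Fails⇒LocalMinima : ∀ I π → Fails I π ≡ true → LocalMinima I π ≡ true
  Fails⇒LocalMinima I π fails =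
    allV-intro _ (λ v → weaken (mem I v) (rank π v ℕ.≡ᵇ 0) (hasLowerNeighbour π v) (allV-elim _ fails v))
    where
    weaken : ∀ c z d → not c ∨ not (z ∨ d) ≡ true → not c ∨ not d ≡ true
    weaken false z     d h = refl
    weaken true  false d h = h

  Fails-dependent : ∀ I π → independent G I ≡ false → injective π ≡ true → Fails I π ≡ false
  Fails-dependent I π dependent π-inj with allV-witness _ dependent
  ... | u , u-bad with allV-witness _ u-bad
  ... | v , uv-bad = BP.¬-not (λ fails → one-is-lower fails (ℕP.<-cmp (rank π u) (rank π v)))
    where
    edge : mem I u ∧ mem I v ∧ adj G u v ≡ true
    edge = BP.not-injective uv-bad
    u∈ : mem I u ≡ true
    u∈ = BP.∧-conicalˡ (mem I u) _ edge
    v∈ : mem I v ≡ true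
    v∈ = BP.∧-conicalˡ (mem I v) _ (BP.∧-conicalʳ (mem I u) _ edge)
    uv : adj G u v ≡ true
    uv = BP.∧-conicalʳ (mem I v) _ (BP.∧-conicalʳ (mem I u) _ edge)
    no-lower : Fails I π ≡ true → ∀ {w} → mem I w ≡ true → hasLowerNeighbour π w ≡ false
    no-lower fails {w} w∈ = BP.∨-conicalʳ (rank π w ℕ.≡ᵇ 0) _ (BP.not-injective (forced (allV-elim _ fails w)))
      where
      forced : not (mem I w) ∨ not (Gv G π w) ≡ true → not (Gv G π w) ≡ true
      forced rewrite w∈ = id
    one-is-lower : Fails I π ≡ true → Tri (rank π u < rank π v) (rank π u ≡ rank π v) (rank π v < rank π u) → ⊥
    one-is-lower fails (tri< u<v _ _) = false≢true (trans (sym (no-lower fails v∈))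
                                          (anyV-intro _ u (cong₂ _∧_ uv (<⇒<ᵇ u<v))))
    one-is-lower fails (tri≈ _ u≡v _) = adj⇒≢ uv (rank-injective {π} π-inj u≡v)
    one-is-lower fails (tri> _ _ v<u) = false≢true (trans (sym (no-lower fails u∈))
                                          (anyV-intro _ v (cong₂ _∧_ (trans (adj-sym G v u) uv) (<⇒<ᵇ v<u))))

  module _ (I : Subset N) (x : Fin N) (p : List (Fin N)) (π : Perm)
           (π-inj : injective π ≡ true) (pre : Prefix (x ∷ p) π ≡ true) where

    rank-next : rank π x ≡ length p
    rank-next = ≡ᵇ⇒≡ (BP.∧-conicalˡ _ _ pre)

    later : ∀ {u} → u ∈ᵇ (x ∷ p) ≡ false → rank π x < rank π u
    later u∉ = subst (_< rank π _) (sym rank-next) (rank-outside (x ∷ p) π-inj pre u∉)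

    no-lower-next : mem I x ≡ true → Avoids I p → hasLowerNeighbour π x ≡ false
    no-lower-next x∈ avoids = anyV-false _ not-lower
      where
      not-lower : ∀ u → (adj G u x ∧ (rank π u ℕ.<ᵇ rank π x)) ≡ false
      not-lower u with adj G u x in ux
      ... | false = refl
      ... | true  = BP.¬-not (λ u<x → ℕP.<-asym (<ᵇ⇒< u<x) (later u∉))
        where
        u∉ : u ∈ᵇ (x ∷ p) ≡ false
        u∉ = cong₂ _∨_ (≢⇒≟ (adj⇒≢ ux)) (avoids (adj⇒∈N I x∈ (trans (adj-sym G x u) ux)))

    LocalMinima-next∈I : mem I x ≡ true → Avoids I p → LocalMinima I π ≡ LocalMinima (I ∖ x) π
    LocalMinima-next∈I x∈ avoids = allV-cong same
      where
      same : ∀ v → (not (mem I v) ∨ not (hasLowerNeighbour π v))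
                   ≡ (not (mem (I ∖ x) v) ∨ not (hasLowerNeighbour π v))
      same v with v ≟ x
      ... | yes v≡x rewrite v≡x | x∈ | no-lower-next x∈ avoids | mem-∖-self I x = refl
      ... | no v≢x  rewrite mem-∖-other I v≢x = refl

    LocalMinima-next∈N : mem I x ≡ false → x ∈N[ I ] ≡ true → Avoids I p → LocalMinima I π ≡ false
    LocalMinima-next∈N x∉ x∈N avoids with ∈N-elim I x∈N
    ... | inj₁ x∈             = ⊥-elim (false≢true (trans (sym x∉) x∈))
    ... | inj₂ (u , u∈ , ux) = allV-false _ u (cong₂ (λ c d → not c ∨ not d) u∈ u-has-lower)
      where
      u≢x : u ≢ x
      u≢x refl = false≢true (trans (sym x∉) u∈)
      u-has-lower : hasLowerNeighbour π u ≡ true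
      u-has-lower = anyV-intro _ x (cong₂ _∧_ (trans (adj-sym G x u) ux)
                                             (<⇒<ᵇ (later (cong₂ _∨_ (≢⇒≟ u≢x) (avoids (mem⇒∈N I u∈))))))

  module _ (I : Subset N) (x : Fin N) (π : Perm)
           (π-inj : injective π ≡ true) (first : Prefix (x ∷ []) π ≡ true) where

    rank-first : (rank π x ℕ.≡ᵇ 0) ≡ true
    rank-first = BP.∧-conicalˡ _ _ first

    Fails-first∈I : mem I x ≡ true → Fails I π ≡ false
    Fails-first∈I x∈ = allV-false _ x (cong₂ (λ c d → not c ∨ not (d ∨ hasLowerNeighbour π x)) x∈ rank-first)

    Fails≡LocalMinima : x ∈N[ I ] ≡ false → Fails I π ≡ LocalMinima I π
    Fails≡LocalMinima x∉N = allV-cong same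
      where
      same : ∀ v → (not (mem I v) ∨ not (Gv G π v)) ≡ (not (mem I v) ∨ not (hasLowerNeighbour π v))
      same v with mem I v in v∈
      ... | false = refl
      ... | true  = cong (λ z → not (z ∨ hasLowerNeighbour π v)) (BP.¬-not not-first)
        where
        not-first : (rank π v ℕ.≡ᵇ 0) ≢ true
        not-first v-first = false≢true (trans (sym x∉N) (subst (λ w → w ∈N[ I ] ≡ true) v≡x (mem⇒∈N I v∈)))
          where
          v≡x : v ≡ x
          v≡x = rank-injective {π} π-inj (trans (≡ᵇ⇒≡ v-first) (sym (≡ᵇ⇒≡ rank-first)))

  LocalMinimaCount : ℕ → Set
  LocalMinimaCount r = ∀ p I → Distinct p → length p ℕ.+ r ≡ N → independent G I ≡ true → Avoids I p →
                       ΣExt p (λ π → ⟦ LocalMinima I π ⟧) ≡ b G I * fromℕ (r !)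

  localMinimaCount-zero : LocalMinimaCount 0
  localMinimaCount-zero p I distinct p+0≡N _ avoids = begin
    ΣExt p (λ π → ⟦ LocalMinima I π ⟧)
      ≡⟨ Sum-cong (bijections N) (λ π → cong (λ c → ⟦ Prefix p π ⟧ * ⟦ c ⟧) (all-minima π)) ⟩
    ΣExt p (λ _ → 1ℚ)
      ≡⟨ ΣExt-full distinct full ⟩
    1ℚ
      ≡⟨ ℚP.*-identityʳ 1ℚ ⟨
    1ℚ * 1ℚ
      ≡⟨ cong (_* 1ℚ) b≡1 ⟨
    b G I * fromℕ (0 !) ∎
    where
    open ≡-Reasoning
    full : length p ≡ N
    full = trans (sym (ℕP.+-identityʳ (length p))) p+0≡N
    ∉I : ∀ v → mem I v ≡ false
    ∉I v = BP.¬-not (λ v∈ → false≢true (trans (sym (avoids (mem⇒∈N I v∈))) (covers distinct full v)))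
    all-minima : ∀ π → LocalMinima I π ≡ true
    all-minima π = allV-intro _ (λ v → cong (λ c → not c ∨ not (hasLowerNeighbour π v)) (∉I v))
    b≡1 : b G I ≡ 1ℚ
    b≡1 = cong (λ k → bAux G k I) (lookup-false⇒∣∣≡0 I ∉I)

  module _ (p : List (Fin N)) (I : Subset N) {r : ℕ} (distinct : Distinct p) (p+r≡N : length p ℕ.+ suc r ≡ N)
           (indep : independent G I ≡ true) (avoids : Avoids I p) where

    private
      F bF : ℚ
      F  = fromℕ (r !)
      bF = b G I * F

    x∷p+r≡N : suc (length p) ℕ.+ r ≡ N
    x∷p+r≡N = trans (sym (ℕP.+-suc (length p) r)) p+r≡N

    contribution : Fin N → ℚ
    contribution x = (if mem I x then b G (I ∖ x) else 0ℚ) * F + ⟦ not (x ∈N[ I ]) ∧ not (x ∈ᵇ p) ⟧ * bF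

    contribution-at : ∀ {x c₁ c₂ c₃} → mem I x ≡ c₁ → x ∈N[ I ] ≡ c₂ → x ∈ᵇ p ≡ c₃ →
                      contribution x ≡ (if c₁ then b G (I ∖ x) else 0ℚ) * F + ⟦ not c₂ ∧ not c₃ ⟧ * bF
    contribution-at {x} {c₁} {c₂} x∈ x∈N x∈p =
      trans (cong₂ (λ c₁ c₂ → (if c₁ then b G (I ∖ x) else 0ℚ) * F + ⟦ not c₂ ∧ not (x ∈ᵇ p) ⟧ * bF) x∈ x∈N)
            (cong (λ c₃ → (if c₁ then b G (I ∖ x) else 0ℚ) * F + ⟦ not c₂ ∧ not c₃ ⟧ * bF) x∈p)

    no-contribution : 0ℚ ≡ 0ℚ * F + 0ℚ * bF
    no-contribution = sym (trans (cong₂ _+_ (ℚP.*-zeroˡ F) (ℚP.*-zeroˡ bF)) (ℚP.+-identityˡ 0ℚ))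

    ΣExt-next : LocalMinimaCount r → ∀ x → ΣExt (x ∷ p) (λ π → ⟦ LocalMinima I π ⟧) ≡ contribution x
    ΣExt-next ih x = by-cases (mem I x) (x ∈N[ I ]) (x ∈ᵇ p) refl refl refl
      where
      open ≡-Reasoning
      by-cases : ∀ c₁ c₂ c₃ → mem I x ≡ c₁ → x ∈N[ I ] ≡ c₂ → x ∈ᵇ p ≡ c₃ →
                 ΣExt (x ∷ p) (λ π → ⟦ LocalMinima I π ⟧) ≡ contribution x
      by-cases true _ _ x∈ _ x∈p = begin
        ΣExt (x ∷ p) (λ π → ⟦ LocalMinima I π ⟧)
          ≡⟨ ΣExt-cong (x ∷ p) (λ {π} π-inj pre → LocalMinima-next∈I I x p π π-inj pre x∈ avoids) ⟩
        ΣExt (x ∷ p) (λ π → ⟦ LocalMinima (I ∖ x) π ⟧)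
          ≡⟨ ih (x ∷ p) (I ∖ x) (avoids (mem⇒∈N I x∈) , distinct) x∷p+r≡N (independent-∖ I x indep) avoids-∖ ⟩
        b G (I ∖ x) * F
          ≡⟨ ℚP.+-identityʳ _ ⟨
        b G (I ∖ x) * F + 0ℚ
          ≡⟨ cong (b G (I ∖ x) * F +_) (ℚP.*-zeroˡ bF) ⟨
        b G (I ∖ x) * F + 0ℚ * bF
          ≡⟨ contribution-at x∈ (mem⇒∈N I x∈) x∈p ⟨
        contribution x ∎
        where
        avoids-∖ : Avoids (I ∖ x) (x ∷ p)
        avoids-∖ {v} v∈N = cong₂ _∨_ (≢⇒≟ v≢x) (avoids (∈N-∖ I x v∈N))
          where
          v≢x : v ≢ x
          v≢x refl with ∈N-elim (I ∖ x) v∈N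
          ... | inj₁ x∈∖x            = false≢true (trans (sym (mem-∖-self I x)) x∈∖x)
          ... | inj₂ (u , u∈ , ux) = false≢true (trans (sym (independent-elim I indep (mem-∖⇒mem I x u∈) x∈)) ux)
      by-cases false true _ x∉ x∈N x∈p =
        trans (ΣExt-zero (x ∷ p) (λ {π} π-inj pre → LocalMinima-next∈N I x p π π-inj pre x∉ x∈N avoids))
              (trans no-contribution (sym (contribution-at x∉ x∈N x∈p)))
      by-cases false false true x∉ x∉N x∈p =
        trans (Sum-zero (bijections N) (λ {π} _ → trans (cong (λ c → ⟦ c ⟧ * ⟦ LocalMinima I π ⟧) (Prefix-repeat x p π x∈p))
                                                        (ℚP.*-zeroˡ ⟦ LocalMinima I π ⟧)))
              (trans no-contribution (sym (contribution-at x∉ x∉N x∈p)))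
      by-cases false false false x∉ x∉N x∉p = begin
        ΣExt (x ∷ p) (λ π → ⟦ LocalMinima I π ⟧)  ≡⟨ ih (x ∷ p) I (x∉p , distinct) x∷p+r≡N indep avoids-x ⟩
        bF                                        ≡⟨ ℚP.*-identityˡ bF ⟨
        1ℚ * bF                                   ≡⟨ ℚP.+-identityˡ _ ⟨
        0ℚ + 1ℚ * bF                              ≡⟨ cong (_+ 1ℚ * bF) (ℚP.*-zeroˡ F) ⟨
        0ℚ * F + 1ℚ * bF                          ≡⟨ contribution-at x∉ x∉N x∉p ⟨
        contribution x                            ∎
        where
        avoids-x : Avoids I (x ∷ p)
        avoids-x {v} v∈N = cong₂ _∨_ (≢⇒≟ v≢x) (avoids v∈N)
          where
          v≢x : v ≢ x
          v≢x refl = false≢true (trans (sym x∉N) v∈N)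

    Sum-contribution : Sum (allFin N) contribution ≡ b G I * fromℕ (suc r !)
    Sum-contribution = begin
      Sum (allFin N) (λ x → (if mem I x then b G (I ∖ x) else 0ℚ) * F + ⟦ fresh x ⟧ * bF)
        ≡⟨ Sum-+ (allFin N) (λ x → (if mem I x then b G (I ∖ x) else 0ℚ) * F) (λ x → ⟦ fresh x ⟧ * bF) ⟩
      Sum (allFin N) (λ x → (if mem I x then b G (I ∖ x) else 0ℚ) * F) + Sum (allFin N) (λ x → ⟦ fresh x ⟧ * bF)
        ≡⟨ cong₂ _+_ (Sum-*ʳ (allFin N) F (λ x → if mem I x then b G (I ∖ x) else 0ℚ))
                     (Sum-*ʳ (allFin N) bF (λ x → ⟦ fresh x ⟧)) ⟩
      Σb∖ I * F + #fresh * bF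
        ≡⟨ cong (λ s → s * F + #fresh * bF) (b-recurrence I) ⟩
      fromℕ (N ∸ a G I) * b G I * F + #fresh * (b G I * F)
        ≡⟨ solve 4 (λ n β f k → n :* β :* f :+ k :* (β :* f) := β :* ((n :+ k) :* f)) refl
                 (fromℕ (N ∸ a G I)) (b G I) F #fresh ⟩
      b G I * ((fromℕ (N ∸ a G I) + #fresh) * F)
        ≡⟨ cong (λ s → b G I * (s * F)) unseen ⟩
      b G I * (fromℕ (suc r) * F)
        ≡⟨ cong (b G I *_) (fromℕ-* (suc r) (r !)) ⟨
      b G I * fromℕ (suc r !) ∎
      where
      open ≡-Reasoning
      open +-*-Solver using (solve; _:+_; _:*_; _:=_)
      fresh : Fin N → Bool
      fresh x = not (x ∈N[ I ]) ∧ not (x ∈ᵇ p)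
      #fresh : ℚ
      #fresh = Sum (allFin N) (λ x → ⟦ fresh x ⟧)
      split : ∀ x → ⟦ x ∈N[ I ] ⟧ + ⟦ fresh x ⟧ ≡ ⟦ not (x ∈ᵇ p) ⟧
      split x with x ∈N[ I ] in x∈N
      ... | true rewrite avoids x∈N = refl
      ... | false = ℚP.+-identityˡ _
      unseen : fromℕ (N ∸ a G I) + #fresh ≡ fromℕ (suc r)
      unseen = begin
        fromℕ (N ∸ a G I) + #fresh
          ≡⟨ cong (_+ #fresh) (fromℕ-N∸a I) ⟩
        Sum (allFin N) (λ x → ⟦ x ∈N[ I ] ⟧) + #fresh
          ≡⟨ Sum-+ (allFin N) (λ x → ⟦ x ∈N[ I ] ⟧) (λ x → ⟦ fresh x ⟧) ⟨
        Sum (allFin N) (λ x → ⟦ x ∈N[ I ] ⟧ + ⟦ fresh x ⟧)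
          ≡⟨ Sum-cong (allFin N) split ⟩
        Sum (allFin N) (λ x → ⟦ not (x ∈ᵇ p) ⟧)
          ≡⟨ Sum-∉ᵇ p (suc r) distinct p+r≡N ⟩
        fromℕ (suc r) ∎

  localMinimaCount : ∀ r → LocalMinimaCount r
  localMinimaCount zero    = localMinimaCount-zero
  localMinimaCount (suc r) p I distinct p+r≡N indep avoids = begin
    ΣExt p (λ π → ⟦ LocalMinima I π ⟧)
      ≡⟨ ΣExt-split p _ (length<N p p+r≡N) ⟩
    Sum (allFin N) (λ x → ΣExt (x ∷ p) (λ π → ⟦ LocalMinima I π ⟧))
      ≡⟨ Sum-cong (allFin N) (ΣExt-next p I distinct p+r≡N indep avoids (localMinimaCount r)) ⟩
    Sum (allFin N) (contribution p I distinct p+r≡N indep avoids)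
      ≡⟨ Sum-contribution p I distinct p+r≡N indep avoids ⟩
    b G I * fromℕ (suc r !) ∎
    where
    open ≡-Reasoning

  count-Fails : ∀ I → independent G I ≡ true →
                Sum (bijections N) (λ π → ⟦ Fails I π ⟧) ≡ fromℕ (a G I) * b G I * fromℕ (m !)
  count-Fails I indep = begin
    Sum (bijections N) (λ π → ⟦ Fails I π ⟧)
      ≡⟨ Sum-cong (bijections N) (λ π → ℚP.*-identityˡ ⟦ Fails I π ⟧) ⟨
    ΣExt [] (λ π → ⟦ Fails I π ⟧)
      ≡⟨ ΣExt-split [] _ (s≤s z≤n) ⟩
    Sum (allFin N) (λ x → ΣExt (x ∷ []) (λ π → ⟦ Fails I π ⟧))
      ≡⟨ Sum-cong (allFin N) first-vertex ⟩
    Sum (allFin N) (λ x → ⟦ not (x ∈N[ I ]) ⟧ * bF)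
      ≡⟨ Sum-*ʳ (allFin N) bF (λ x → ⟦ not (x ∈N[ I ]) ⟧) ⟩
    Sum (allFin N) (λ x → ⟦ not (x ∈N[ I ]) ⟧) * bF
      ≡⟨ cong (_* bF) (fromℕ-countL (λ x → not (x ∈N[ I ])) (allFin N)) ⟨
    fromℕ (a G I) * (b G I * fromℕ (m !))
      ≡⟨ ℚP.*-assoc (fromℕ (a G I)) (b G I) (fromℕ (m !)) ⟨
    fromℕ (a G I) * b G I * fromℕ (m !) ∎
    where
    open ≡-Reasoning
    bF : ℚ
    bF = b G I * fromℕ (m !)
    first-vertex : ∀ x → ΣExt (x ∷ []) (λ π → ⟦ Fails I π ⟧) ≡ ⟦ not (x ∈N[ I ]) ⟧ * bF
    first-vertex x = by-cases (x ∈N[ I ]) (mem I x) refl refl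
      where
      none : ΣExt (x ∷ []) (λ π → ⟦ Fails I π ⟧) ≡ 0ℚ → x ∈N[ I ] ≡ true →
             ΣExt (x ∷ []) (λ π → ⟦ Fails I π ⟧) ≡ ⟦ not (x ∈N[ I ]) ⟧ * bF
      none Σ≡0 x∈N = trans Σ≡0 (sym (trans (cong (λ c → ⟦ not c ⟧ * bF) x∈N) (ℚP.*-zeroˡ bF)))
      by-cases : ∀ c₁ c₂ → x ∈N[ I ] ≡ c₁ → mem I x ≡ c₂ →
                 ΣExt (x ∷ []) (λ π → ⟦ Fails I π ⟧) ≡ ⟦ not (x ∈N[ I ]) ⟧ * bF
      by-cases false _ x∉N _ = begin
        ΣExt (x ∷ []) (λ π → ⟦ Fails I π ⟧)
          ≡⟨ ΣExt-cong (x ∷ []) (λ {π} π-inj first → Fails≡LocalMinima I x π π-inj first x∉N) ⟩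
        ΣExt (x ∷ []) (λ π → ⟦ LocalMinima I π ⟧)
          ≡⟨ localMinimaCount m (x ∷ []) I (refl , tt) refl indep avoids-x ⟩
        bF
          ≡⟨ ℚP.*-identityˡ bF ⟨
        1ℚ * bF
          ≡⟨ cong (λ c → ⟦ not c ⟧ * bF) x∉N ⟨
        ⟦ not (x ∈N[ I ]) ⟧ * bF ∎
        where
        avoids-x : Avoids I (x ∷ [])
        avoids-x {v} v∈N = cong (_∨ false) (≢⇒≟ v≢x)
          where
          v≢x : v ≢ x
          v≢x refl = false≢true (trans (sym x∉N) v∈N)
      by-cases true true x∈N x∈ =
        none (ΣExt-zero (x ∷ []) (λ {π} π-inj first → Fails-first∈I I x π π-inj first x∈)) x∈N
      by-cases true false x∈N x∉ = none (ΣExt-zero (x ∷ []) (λ {π} → not-minimal {π})) x∈N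
        where
        not-minimal : ∀ {π} → injective π ≡ true → Prefix (x ∷ []) π ≡ true → Fails I π ≡ false
        not-minimal {π} π-inj first = BP.¬-not (λ fails → false≢true
          (trans (sym (LocalMinima-next∈N I x [] π π-inj first x∉ x∈N (λ _ → refl)))
                 (Fails⇒LocalMinima I π fails)))

  GU-inclusion-exclusion : ∀ U π →
    ⟦ GU G U π ⟧ ≡ Sum (subsets N) (λ I → if subsetOf I U then sign ∣ I ∣ * ⟦ Fails I π ⟧ else 0ℚ)
  GU-inclusion-exclusion U π = begin
    ⟦ GU G U π ⟧                         ≡⟨ cong ⟦_⟧ GU≡Disjoint ⟩
    ⟦ Disjointᵇ U failing ⟧              ≡⟨ inclusion-exclusion N U failing ⟨
    Sum (subsets N) (ie-term U failing)  ≡⟨ Sum-cong (subsets N) term≡ ⟩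
    Sum (subsets N) (λ I → if subsetOf I U then sign ∣ I ∣ * ⟦ Fails I π ⟧ else 0ℚ) ∎
    where
    open ≡-Reasoning
    failing : Subset N
    failing = tabulate (λ v → not (Gv G π v))
    lookup-failing : ∀ v → lookup failing v ≡ not (Gv G π v)
    lookup-failing = VP.lookup∘tabulate (λ v → not (Gv G π v))
    de-morgan : ∀ u g → not u ∨ g ≡ not (u ∧ not g)
    de-morgan false g = refl
    de-morgan true  g = sym (BP.not-involutive g)
    GU≡Disjoint : GU G U π ≡ Disjointᵇ U failing
    GU≡Disjoint = trans (allV-cong (λ v → trans (de-morgan (mem U v) (Gv G π v))
                                                (cong (λ c → not (mem U v ∧ c)) (sym (lookup-failing v)))))
                        (allV-lookup₂ N (λ x y → not (x ∧ y)) U failing)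
    ⊆failing : ∀ I → I ⊆ᵇ failing ≡ Fails I π
    ⊆failing I = trans (sym (allV-lookup₂ N (λ x y → not x ∨ y) I failing))
                       (allV-cong (λ v → cong (λ c → not (mem I v) ∨ c) (lookup-failing v)))
    term≡ : ∀ I → ie-term U failing I ≡ (if subsetOf I U then sign ∣ I ∣ * ⟦ Fails I π ⟧ else 0ℚ)
    term≡ I = cong₂ (λ c d → if c then sign ∣ I ∣ * ⟦ d ⟧ else 0ℚ)
                    (sym (allV-lookup₂ N (λ x y → not x ∨ y) I U)) (⊆failing I)

  Pr-term : ∀ U I →
    Sum (bijections N) (λ π → if subsetOf I U then sign ∣ I ∣ * ⟦ Fails I π ⟧ else 0ℚ) * inv (length (bijections N))
      ≡ (if subsetOf I U ∧ independent G I then sign ∣ I ∣ * fromℕ (a G I) * b G I * inv N else 0ℚ)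
  Pr-term U I = by-cases (subsetOf I U) (independent G I) refl refl
    where
    open ≡-Reasoning
    iL : ℚ
    iL = inv (length (bijections N))
    term : Perm → ℚ
    term π = if subsetOf I U then sign ∣ I ∣ * ⟦ Fails I π ⟧ else 0ℚ
    value : ℚ
    value = sign ∣ I ∣ * fromℕ (a G I) * b G I * inv N
    vanishes : (∀ {π} → π ∈ bijections N → term π ≡ 0ℚ) → subsetOf I U ∧ independent G I ≡ false →
               Sum (bijections N) term * iL ≡ (if subsetOf I U ∧ independent G I then value else 0ℚ)
    vanishes term≡0 unselected = begin
      Sum (bijections N) term * iL                               ≡⟨ cong (_* iL) (Sum-zero (bijections N) term≡0) ⟩
      0ℚ * iL                                                    ≡⟨ ℚP.*-zeroˡ iL ⟩
      0ℚ                                                         ≡⟨ cong (λ c → if c then value else 0ℚ) unselected ⟨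
      (if subsetOf I U ∧ independent G I then value else 0ℚ)     ∎
    by-cases : ∀ c d → subsetOf I U ≡ c → independent G I ≡ d →
               Sum (bijections N) term * iL ≡ (if subsetOf I U ∧ independent G I then value else 0ℚ)
    by-cases false _ I⊈U _ = vanishes (λ {π} _ → cong (λ c → if c then sign ∣ I ∣ * ⟦ Fails I π ⟧ else 0ℚ) I⊈U)
                                      (cong (_∧ independent G I) I⊈U)
    by-cases true false I⊆U dependent = vanishes fails-never (cong₂ _∧_ I⊆U dependent)
      where
      fails-never : ∀ {π} → π ∈ bijections N → term π ≡ 0ℚ
      fails-never {π} π∈ = begin
        term π
          ≡⟨ cong (λ c → if c then sign ∣ I ∣ * ⟦ Fails I π ⟧ else 0ℚ) I⊆U ⟩
        sign ∣ I ∣ * ⟦ Fails I π ⟧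
          ≡⟨ cong (λ c → sign ∣ I ∣ * ⟦ c ⟧) (Fails-dependent I π dependent (∈bijections⇒injective π∈)) ⟩
        sign ∣ I ∣ * 0ℚ
          ≡⟨ ℚP.*-zeroʳ (sign ∣ I ∣) ⟩
        0ℚ ∎
    by-cases true true I⊆U indep = begin
      Sum (bijections N) term * iL
        ≡⟨ cong (_* iL) (Sum-cong (bijections N) (λ π → cong (λ c → if c then sign ∣ I ∣ * ⟦ Fails I π ⟧ else 0ℚ) I⊆U)) ⟩
      Sum (bijections N) (λ π → sign ∣ I ∣ * ⟦ Fails I π ⟧) * iL
        ≡⟨ cong (_* iL) (Sum-*ˡ (bijections N) (sign ∣ I ∣) (λ π → ⟦ Fails I π ⟧)) ⟩
      sign ∣ I ∣ * Sum (bijections N) (λ π → ⟦ Fails I π ⟧) * iL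
        ≡⟨ cong (λ z → sign ∣ I ∣ * z * iL) (count-Fails I indep) ⟩
      sign ∣ I ∣ * (fromℕ (a G I) * b G I * fromℕ (m !)) * iL
        ≡⟨ solve 5 (λ s α β f i → s :* (α :* β :* f) :* i := s :* α :* β :* (f :* i)) refl
                 (sign ∣ I ∣) (fromℕ (a G I)) (b G I) (fromℕ (m !)) iL ⟩
      sign ∣ I ∣ * fromℕ (a G I) * b G I * (fromℕ (m !) * iL)
        ≡⟨ cong (sign ∣ I ∣ * fromℕ (a G I) * b G I *_) m!*inv-length ⟩
      value
        ≡⟨ cong₂ (λ c d → if c ∧ d then value else 0ℚ) I⊆U indep ⟨
      (if subsetOf I U ∧ independent G I then value else 0ℚ) ∎
      where open +-*-Solver using (solve; _:*_; _:=_)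

proposition3p1 : (n : ℕ) → 1 ≤ n → (G : Graph n) → Connected G →
    (U : Subset n) → Pr G U ≡ rhs G U
proposition3p1 (suc m) _ G _ U = begin
  Pr G U
    ≡⟨ cong (_* iL) (fromℕ-countL (GU G U) (bijections N)) ⟩
  Sum (bijections N) (λ π → ⟦ GU G U π ⟧) * iL
    ≡⟨ cong (_* iL) (Sum-cong (bijections N) (GU-inclusion-exclusion G U)) ⟩
  Sum (bijections N) (λ π → Sum (subsets N) (λ I → w I π)) * iL
    ≡⟨ cong (_* iL) (Sum-swap (bijections N) (subsets N) (λ π I → w I π)) ⟩
  Sum (subsets N) (λ I → Sum (bijections N) (w I)) * iL
    ≡⟨ Sum-*ʳ (subsets N) iL (λ I → Sum (bijections N) (w I)) ⟨
  Sum (subsets N) (λ I → Sum (bijections N) (w I) * iL)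
    ≡⟨ Sum-cong (subsets N) (Pr-term G U) ⟩
  Sum (subsets N) (λ I → if selected I then t I else 0ℚ)
    ≡⟨ Sum-filter (subsets N) selected t ⟨
  Sum (filter (B.T? ∘ selected) (subsets N)) t
    ≡⟨ LP.foldr-map _+_ t 0ℚ (filter (B.T? ∘ selected) (subsets N)) ⟨
  rhs G U ∎
  where
  open Bijections m
  open ≡-Reasoning
  iL : ℚ
  iL = inv (length (bijections N))
  w : Subset N → Perm → ℚ
  w I π = if subsetOf I U then sign ∣ I ∣ * ⟦ Fails G I π ⟧ else 0ℚ
  selected : Subset N → Bool
  selected I = subsetOf I U ∧ independent G I
  t : Subset N → ℚ
  t I = sign ∣ I ∣ * fromℕ (a G I) * b G I * inv N
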